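{- Let $n\geq 3$. Then the sets on the right-hand side below are pairwise disjoint and \begin{multline*} \mathcal{J}(\mathcal{L}_{n+1})= \left(\mathcal{J}(\mathcal{L}_n)\cap \mathrm{Cl}(n) \right)^{\downarrow_1} \sqcup \left(\mathcal{J}(\mathcal{L}_n)\cap \mathrm{NP}(n) \right)^{\downarrow_1} \sqcup \left(\mathcal{J}(\mathcal{L}_n)\cap \mathrm{Ss}(n) \right)^{\downarrow_2}\\ \sqcup \left(\mathcal{J}(\mathcal{L}_n)\cap \mathrm{NS}(n) \right)^{\downarrow_2} \sqcup\bigsqcup_{1\leq l <n} \left(\mathcal{J}(\mathcal{L}_n)\cap \mathrm{PP}_l(n) \right)^{\downarrow_{l+2}} \sqcup E_1(n+1) \sqcup E_2(n+1), \end{multline*} where $E_1(n+1)=\{(2,1,\ldots,1)\}$ (the partition of $n+1$ with one part $2$ and $n-1$ parts $1$) and $E_2(n+1)$ is the set of partitions of $n+1$ of the form $(3,\ldots,3,1,\ldots,1)$ with $m\geq1$ parts equal to $3$ followed by $l\geq 1$ parts equal to $1$.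
   Context: A partition of a positive integer $n$ is an $n$-tuple $\vec\alpha=(a_1,\ldots,a_n)$ of natural numbers with $a_1\geq\cdots\geq a_n\geq0$ and $\sum a_i=n$ (trailing zeros may be omitted; set $a_i=0$ for $i>n$). The dominance ordering: $(a_i)\geq(b_i)$ iff $\sum_{i=1}^j a_i\geq\sum_{i=1}^j b_i$ for all $j\geq1$; the partitions of $n$ with this order form a lattice $\mathcal{L}_n$, and $\mathcal{J}(\mathcal{L}_n)$ is its set of join-irreducible elements (elements covering exactly one element). For a partition $\vec\alpha=(a_1,\ldots,a_n)$ of $n$ and $i\in\{1,\ldots,n\}$, $\vec\alpha^{\downarrow_i}$ is the $(n+1)$-tuple $(a_1,\ldots,a_{i-1},a_i+1,a_{i+1},\ldots,a_n,0)$, and $\vec\alpha^{\downarrow_{n+1}}=(a_1,\ldots,a_n,1)$; for a set $A$ of partitions, $A^{\downarrow_i}=\{\vec\alpha^{\downarrow_i}:\vec\alpha\in A\}$. Let $d_j(\vec\alpha)=a_j-a_{j+1}$. $\vec\alpha$ has a cliff at $j$ if $d_j(\vec\alpha)\geq2$; a slippery plateau of length $k-j$ at $j$ if there is $k>j$ with $d_i(\vec\alpha)=0$ for all $i\in\{j,\ldots,k-1\}$ and $d_k(\vec\alpha)=1$; a non-slippery plateau (of length $k-j$) at $j$ if there is $k>j$ with $d_i(\vec\alpha)=0$ for $i\in\{j,\ldots,k-1\}$ and $\vec\alpha$ has a cliff at $k$; a slippery step at $j$ if $(a_1,\ldots,a_j-1,\ldots,a_n)$ is a partition with a slippery plateau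 at $j$; a non-slippery step at $j$ if $(a_1,\ldots,a_j-1,\ldots,a_n)$ is a partition with a non-slippery plateau at $j$. $\mathrm{Cl}(n)$, $\mathrm{Ss}(n)$, $\mathrm{NS}(n)$, $\mathrm{PP}_l(n)$, $\mathrm{NP}(n)$ denote the sets of partitions of $n$ having, respectively, a cliff at $1$, a slippery step at $1$, a non-slippery step at $1$, a slippery plateau of length $l\geq1$ at $1$, and a non-slippery plateau at $1$. -}

module Defs where

open import Data.Nat using (ℕ; zero; suc; _+_; _*_; _∸_; _≤_; _<_; pred)
open import Data.Vec using (Vec; []; _∷_; _∷ʳ_; lookup; sum)
open import Data.Fin using (Fin; toℕ)
open import Data.Product using (Σ; _×_; ∃; ∃-syntax)
open import Relation.Binary.PropositionalEquality using (_≡_; _≢_)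
open import Relation.Nullary using (¬_)

-- 1-based access to a tuple; entries beyond the length (and index 0, unused) are 0.
get : ∀ {n} → Vec ℕ n → ℕ → ℕ
get []       _             = 0
get (x ∷ xs) zero          = 0
get (x ∷ xs) (suc zero)    = x
get (x ∷ xs) (suc (suc i)) = get xs (suc i)

NonIncreasing : ∀ {n} → Vec ℕ n → Set
NonIncreasing a = ∀ i → 1 ≤ i → get a (suc i) ≤ get a i

IsPartition : ∀ {n} → ℕ → Vec ℕ n → Set
IsPartition m a = NonIncreasing a × sum a ≡ m

psum : ∀ {n} → Vec ℕ n → ℕ → ℕ
psum a zero    = 0
psum a (suc j) = psum a j + get a (suc j)

Dominates : ∀ {n} → Vec ℕ n → Vec ℕ n → Set
Dominates a b = ∀ j → 1 ≤ j → psum b j ≤ psum a j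

StrictlyBelow : ∀ {n} → Vec ℕ n → Vec ℕ n → Set
StrictlyBelow b a = Dominates a b × b ≢ a

Covers : (n : ℕ) → Vec ℕ n → Vec ℕ n → Set
Covers n a b = IsPartition n b × StrictlyBelow b a
  × ((c : Vec ℕ n) → IsPartition n c → StrictlyBelow b c → ¬ StrictlyBelow c a)

JoinIrr : (n : ℕ) → Vec ℕ n → Set
JoinIrr n a = IsPartition n a × (∃[ b ] Covers n a b)
  × ((b b' : Vec ℕ n) → Covers n a b → Covers n a b' → b ≡ b')

d : ∀ {n} → Vec ℕ n → ℕ → ℕ
d a j = get a j ∸ get a (suc j)

Cliff : ∀ {n} → Vec ℕ n → ℕ → Set
Cliff a j = 2 ≤ d a j

SlipPlateauTo : ∀ {n} → Vec ℕ n → ℕ → ℕ → Set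
SlipPlateauTo a j k = j < k × (∀ i → j ≤ i → i < k → d a i ≡ 0) × d a k ≡ 1

SlipPlateau : ∀ {n} → Vec ℕ n → ℕ → Set
SlipPlateau a j = ∃[ k ] SlipPlateauTo a j k

SlipPlateauLen : ∀ {n} → Vec ℕ n → ℕ → ℕ → Set
SlipPlateauLen a j l = 1 ≤ l × SlipPlateauTo a j (j + l)

NonSlipPlateau : ∀ {n} → Vec ℕ n → ℕ → Set
NonSlipPlateau a j = ∃[ k ] (j < k × (∀ i → j ≤ i → i < k → d a i ≡ 0) × Cliff a k)

decAt : ∀ {n} → ℕ → Vec ℕ n → Vec ℕ n
decAt _             []       = []
decAt zero          (x ∷ xs) = x ∷ xs
decAt (suc zero)    (x ∷ xs) = pred x ∷ xs
decAt (suc (suc j)) (x ∷ xs) = x ∷ decAt (suc j) xs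

SlipStep : (n : ℕ) → Vec ℕ n → ℕ → Set
SlipStep n a j = 1 ≤ get a j × IsPartition (pred n) (decAt j a) × SlipPlateau (decAt j a) j

NonSlipStep : (n : ℕ) → Vec ℕ n → ℕ → Set
NonSlipStep n a j = 1 ≤ get a j × IsPartition (pred n) (decAt j a) × NonSlipPlateau (decAt j a) j

Cl Ss NS NP : (n : ℕ) → Vec ℕ n → Set
Cl n a = IsPartition n a × Cliff a 1
Ss n a = IsPartition n a × SlipStep n a 1
NS n a = IsPartition n a × NonSlipStep n a 1
NP n a = IsPartition n a × NonSlipPlateau a 1

PP : (l n : ℕ) → Vec ℕ n → Set
PP l n a = IsPartition n a × SlipPlateauLen a 1 l

-- α^{↓i}: for 1 ≤ i ≤ n add 1 to the i-th entry and append 0; for i = n+1 append 1.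
-- (i = 0 is never used.)
down : ∀ {n} → ℕ → Vec ℕ n → Vec ℕ (suc n)
down zero          xs       = xs ∷ʳ 0
down (suc i)       []       = 1 ∷ []
down (suc zero)    (x ∷ xs) = suc x ∷ (xs ∷ʳ 0)
down (suc (suc i)) (x ∷ xs) = x ∷ down (suc i) xs

InImage : (n : ℕ) → (Vec ℕ n → Set) → ℕ → Vec ℕ (suc n) → Set
InImage n S i β = ∃[ α ] (JoinIrr n α × S α × down i α ≡ β)

E1 : (n : ℕ) → Vec ℕ (suc n) → Set
E1 n β = (i : Fin (suc n)) → lookup β i ≡ f (toℕ i)
  where
  f : ℕ → ℕ
  f zero = 2
  f (suc k) with suc k Data.Nat.<? n
  ... | Relation.Nullary.yes _ = 1
  ... | Relation.Nullary.no _  = 0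

E2 : (n : ℕ) → Vec ℕ (suc n) → Set
E2 n β = ∃[ m ] ∃[ l ] (1 ≤ m × 1 ≤ l × 3 * m + l ≡ suc n
  × ((i : Fin (suc n)) → lookup β i ≡ f m l (toℕ i)))
  where
  f : ℕ → ℕ → ℕ → ℕ
  f m l i with i Data.Nat.<? m | i Data.Nat.<? m + l
  ... | Relation.Nullary.yes _ | _ = 3
  ... | Relation.Nullary.no _ | Relation.Nullary.yes _ = 1
  ... | Relation.Nullary.no _ | Relation.Nullary.no _ = 0

data Piece : Set where
  cl np ss ns : Piece
  pp : ℕ → Piece
  e1 e2 : Piece

InPiece : (n : ℕ) → Piece → Vec ℕ (suc n) → Set
InPiece n cl     β = InImage n (Cl n) 1 β
InPiece n np     β = InImage n (NP n) 1 β
InPiece n ss     β = InImage n (Ss n) 2 β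
InPiece n ns     β = InImage n (NS n) 2 β
InPiece n (pp l) β = 1 ≤ l × l < n × InImage n (PP l n) (l + 2) β
InPiece n e1     β = E1 n β
InPiece n e2     β = E2 n β

module Submission where

open import Defs
open import Data.Nat
open import Data.Nat.Properties
open import Data.Vec using (Vec; []; _∷_; _∷ʳ_; sum; lookup)
open import Data.Vec.Properties using (≡-dec)
open import Data.Fin using (Fin; toℕ; fromℕ<)
open import Data.Fin.Properties using (toℕ<n; toℕ-fromℕ<)
open import Data.Product
open import Data.Sum using (_⊎_; inj₁; inj₂)
open import Data.Empty
open import Relation.Nullary
open import Relation.Nullary.Decidable using (_×-dec_; decidable-stable)
open import Relation.Binary.PropositionalEquality
open import Function.Bundles using (_⇔_; mk⇔)

{-
Following Brylawski, a partition a covers b in the dominance order exactly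
when b arises from a by a single move: one unit leaves row i for a row k > i,
where a_i ≥ a_k + 2 and every row strictly between has height a_i - 1 = a_k + 1.
Hence a is join-irreducible iff it admits exactly one move.  Adding a cell in
row p changes the moves only around row p, so when p ends the top plateau of
α^{↓p}, the unique move of α^{↓p} is governed by the unique move of α and the
shape of α at its top: a cliff or a non-slippery plateau (p = 1), a step
(p = 2) or a slippery plateau of length l (p = l + 2).  Conversely, removing
that cell from a join-irreducible partition of n + 1 leaves a join-irreducible
partition of n, except for the two families E₁ and E₂.
-}

-- Natural numbers, prefix sums and the dominance order

1≤⇒≡1∨≥2 : ∀ {i} → 1 ≤ i → (i ≡ 1) ⊎ (2 ≤ i)
1≤⇒≡1∨≥2 {suc zero} _ = inj₁ refl
1≤⇒≡1∨≥2 {suc (suc i)} _ = inj₂ (s≤s (s≤s z≤n))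

trichotomy : ∀ i p → (i < p) ⊎ ((i ≡ p) ⊎ (p < i))
trichotomy i p with i <? p
... | yes lt = inj₁ lt
... | no nlt with m≤n⇒m<n∨m≡n (≮⇒≥ nlt)
...   | inj₁ lt = inj₂ (inj₂ lt)
...   | inj₂ e = inj₂ (inj₁ (sym e))

≡0∨≡1∨≥2 : ∀ x → (x ≡ 0) ⊎ ((x ≡ 1) ⊎ (2 ≤ x))
≡0∨≡1∨≥2 zero = inj₁ refl
≡0∨≡1∨≥2 (suc zero) = inj₂ (inj₁ refl)
≡0∨≡1∨≥2 (suc (suc x)) = inj₂ (inj₂ (s≤s (s≤s z≤n)))

∸≡0⇒≡ : ∀ x y → y ≤ x → x ∸ y ≡ 0 → y ≡ x
∸≡0⇒≡ x y le e = ≤-antisym le (m∸n≡0⇒m≤n e)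

∸≡1⇒suc≡ : ∀ x y → x ∸ y ≡ 1 → suc y ≡ x
∸≡1⇒suc≡ zero zero ()
∸≡1⇒suc≡ (suc zero) zero e = refl
∸≡1⇒suc≡ (suc (suc x)) zero ()
∸≡1⇒suc≡ zero (suc y) ()
∸≡1⇒suc≡ (suc x) (suc y) e = cong suc (∸≡1⇒suc≡ x y e)

∸≥2⇒2+≤ : ∀ x y → 2 ≤ x ∸ y → suc (suc y) ≤ x
∸≥2⇒2+≤ zero zero ()
∸≥2⇒2+≤ (suc x) zero le = le
∸≥2⇒2+≤ zero (suc y) ()
∸≥2⇒2+≤ (suc x) (suc y) le = s≤s (∸≥2⇒2+≤ x y le)

≡⇒∸≡0 : ∀ x y → y ≡ x → x ∸ y ≡ 0
≡⇒∸≡0 x y refl = n∸n≡0 x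

suc≡⇒∸≡1 : ∀ x y → suc y ≡ x → x ∸ y ≡ 1
suc≡⇒∸≡1 .(suc y) y refl = m+n∸n≡m 1 y

2+≤⇒2≤∸ : ∀ x y → suc (suc y) ≤ x → 2 ≤ x ∸ y
2+≤⇒2≤∸ (suc x) zero le = le
2+≤⇒2≤∸ (suc x) (suc y) le = 2+≤⇒2≤∸ x y (≤-pred le)

get-beyond : ∀ {n} (a : Vec ℕ n) j → n < j → get a j ≡ 0
get-beyond [] j _ = refl
get-beyond (x ∷ xs) zero ()
get-beyond (x ∷ xs) (suc zero) (s≤s ())
get-beyond (x ∷ xs) (suc (suc j)) (s≤s p) = get-beyond xs (suc j) p

get-ext : ∀ {n} (a b : Vec ℕ n) → (∀ j → 1 ≤ j → get a j ≡ get b j) → a ≡ b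
get-ext [] [] _ = refl
get-ext (x ∷ xs) (y ∷ ys) h = cong₂ _∷_ (h 1 (s≤s z≤n)) (get-ext xs ys h')
  where
  h' : ∀ j → 1 ≤ j → get xs j ≡ get ys j
  h' (suc j) _ = h (suc (suc j)) (s≤s z≤n)

psum-cons : ∀ {n} x (xs : Vec ℕ n) j → psum (x ∷ xs) (suc j) ≡ x + psum xs j
psum-cons x xs zero = +-comm 0 x
psum-cons x xs (suc j) = trans (cong (_+ get xs (suc j)) (psum-cons x xs j)) (+-assoc x (psum xs j) _)

psum-sum : ∀ {n} (a : Vec ℕ n) j → n ≤ j → psum a j ≡ sum a
psum-sum [] zero _ = refl
psum-sum [] (suc j) _ = trans (+-identityʳ _) (psum-sum [] j z≤n)
psum-sum (x ∷ xs) (suc j) (s≤s p) = trans (psum-cons x xs j) (cong (x +_) (psum-sum xs j p))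

psum-ext : ∀ {n} (a b : Vec ℕ n) → (∀ j → 1 ≤ j → psum a j ≡ psum b j) → a ≡ b
psum-ext [] [] _ = refl
psum-ext (x ∷ xs) (y ∷ ys) h = cong₂ _∷_ x≡y (psum-ext xs ys h')
  where
  x≡y : x ≡ y
  x≡y = begin
    x                   ≡⟨ sym (+-identityʳ x) ⟩
    x + 0               ≡⟨ sym (psum-cons x xs 0) ⟩
    psum (x ∷ xs) 1     ≡⟨ h 1 (s≤s z≤n) ⟩
    psum (y ∷ ys) 1     ≡⟨ psum-cons y ys 0 ⟩
    y + 0               ≡⟨ +-identityʳ y ⟩
    y                   ∎
    where open ≡-Reasoning
  h' : ∀ j → 1 ≤ j → psum xs j ≡ psum ys j
  h' j _ = +-cancelˡ-≡ x _ _ (begin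
    x + psum xs j           ≡⟨ sym (psum-cons x xs j) ⟩
    psum (x ∷ xs) (suc j)   ≡⟨ h (suc j) (s≤s z≤n) ⟩
    psum (y ∷ ys) (suc j)   ≡⟨ psum-cons y ys j ⟩
    y + psum ys j           ≡⟨ cong (_+ psum ys j) (sym x≡y) ⟩
    x + psum ys j           ∎)
    where open ≡-Reasoning

psum-cong : ∀ {n m} (x : Vec ℕ n) (y : Vec ℕ m) J → (∀ j → 1 ≤ j → j ≤ J → get x j ≡ get y j) → psum x J ≡ psum y J
psum-cong x y zero h = refl
psum-cong x y (suc J) h = cong₂ _+_ (psum-cong x y J (λ j a b → h j a (≤-trans b (n≤1+n J)))) (h (suc J) (s≤s z≤n) ≤-refl)

dominates-antisym : ∀ {n} (a b : Vec ℕ n) → Dominates a b → Dominates b a → a ≡ b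
dominates-antisym a b p q = psum-ext a b (λ j h → ≤-antisym (q j h) (p j h))

dominates-trans : ∀ {n} {a b c : Vec ℕ n} → Dominates a b → Dominates b c → Dominates a c
dominates-trans p q j h = ≤-trans (q j h) (p j h)

dominates-reflexive : ∀ {n} {a b : Vec ℕ n} → a ≡ b → Dominates a b
dominates-reflexive refl j h = ≤-refl

-- Moves

-- Moves are stated for functions ℕ → ℕ, which tuples become through get (0 beyond their length),
-- so that α and α^{↓p}, of different lengths, can be compared row by row.
NonIncreasingFn : (ℕ → ℕ) → Set
NonIncreasingFn f = ∀ i → 1 ≤ i → f (suc i) ≤ f i

antitone : ∀ {f} → NonIncreasingFn f → ∀ {i j} → 1 ≤ i → i ≤ j → f j ≤ f i
antitone {f} ni {i} {j} h le with m≤n⇒∃[o]m+o≡n le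
... | o , refl = go o
  where
  go : ∀ m → f (i + m) ≤ f i
  go zero rewrite +-identityʳ i = ≤-refl
  go (suc m) rewrite +-suc i m = ≤-trans (ni (i + m) (≤-trans h (m≤m+n i m))) (go m)

Staircase : (ℕ → ℕ) → ℕ → ℕ → Set
Staircase f i k = ∀ j → i < j → j < k → (suc (f j) ≡ f i) × (suc (f k) ≡ f j)

Move : (ℕ → ℕ) → ℕ → ℕ → Set
Move f i k = 1 ≤ i × i < k × suc (suc (f k)) ≤ f i × Staircase f i k

OnlyMove : (ℕ → ℕ) → ℕ → ℕ → Set
OnlyMove f i k = ∀ i' k' → Move f i' k' → (i' ≡ i) × (k' ≡ k)

UniqueMove : (ℕ → ℕ) → Set
UniqueMove f = Σ ℕ λ i → Σ ℕ λ k → Move f i k × OnlyMove f i k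

between-adjacent : ∀ {P : ℕ → Set} {i} j → i < j → j < suc i → P j
between-adjacent j i<j j<si = ⊥-elim (<⇒≱ i<j (≤-pred j<si))

cliff⇒move : ∀ {f i} → 1 ≤ i → suc (suc (f (suc i))) ≤ f i → Move f i (suc i)
cliff⇒move 1≤i c = 1≤i , ≤-refl , c , between-adjacent

move-source-pos : ∀ {f i k} → Move f i k → 1 ≤ f i
move-source-pos (_ , _ , c , _) = ≤-trans (s≤s z≤n) c

no-move-at-flat : ∀ {f i k} → f (suc i) ≡ f i → ¬ Move f i k
no-move-at-flat {f} {i} {k} e (h1 , h2 , c , bt) with m≤n⇒m<n∨m≡n h2
... | inj₂ refl = <-irrefl refl (≤-trans (n≤1+n _) (≤-trans c (≤-reflexive (sym e))))
... | inj₁ lt = <-irrefl refl (≤-reflexive (trans (proj₁ (bt (suc i) ≤-refl lt)) (sym e)))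

move⇒drop : ∀ {f i k} → Move f i k → f (suc i) < f i
move⇒drop {f} {i} {k} (h1 , h2 , c , bt) with m≤n⇒m<n∨m≡n h2
... | inj₂ refl = ≤-trans (s≤s (n≤1+n _)) c
... | inj₁ lt = ≤-reflexive (proj₁ (bt (suc i) ≤-refl lt))

move-cong : ∀ {f g i k} → (∀ j → i ≤ j → j ≤ k → f j ≡ g j) → Move f i k → Move g i k
move-cong {f} {g} {i} {k} eq (h1 , h2 , c , bt) =
  h1 , h2 , subst₂ (λ x y → suc (suc x) ≤ y) (eq k (<⇒≤ h2) ≤-refl) (eq i ≤-refl (<⇒≤ h2)) c ,
  λ j i<j j<k → subst₂ (λ x y → suc x ≡ y) (eq j (<⇒≤ i<j) (<⇒≤ j<k)) (eq i ≤-refl (<⇒≤ h2)) (proj₁ (bt j i<j j<k)) ,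
                subst₂ (λ x y → suc x ≡ y) (eq k (<⇒≤ h2) ≤-refl) (eq j (<⇒≤ i<j) (<⇒≤ j<k)) (proj₂ (bt j i<j j<k))

drop-cases : ∀ x y → y ≤ x → (suc (suc y) ≤ x) ⊎ ((suc y ≡ x) ⊎ (y ≡ x))
drop-cases x y le with m≤n⇒m<n∨m≡n le
... | inj₂ e = inj₂ (inj₂ e)
... | inj₁ lt with m≤n⇒m<n∨m≡n lt
... | inj₁ lt2 = inj₁ lt2
... | inj₂ e = inj₂ (inj₁ e)

MoveBetween : (ℕ → ℕ) → ℕ → ℕ → Set
MoveBetween f i K = Σ ℕ λ i' → Σ ℕ λ k' → i ≤ i' × k' ≤ K × Move f i' k'

-- Walking right from i, the first cliff, or the end of the first plateau of height f i - 1, is a move.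
module FindMove (f : ℕ → ℕ) (ni : NonIncreasingFn f) where
  from-plateau : ∀ m i p → 1 ≤ i → i < p → suc (f p) ≡ f i → (∀ j → i < j → j ≤ p → f j ≡ f p)
               → suc (f (p + suc m)) ≤ f p → MoveBetween f i (p + suc m)
  from-plateau m i p h1 h2 eP eqs bd with drop-cases (f p) (f (suc p)) (ni p (≤-trans h1 (<⇒≤ h2)))
  ... | inj₁ cL = p , suc p , <⇒≤ h2 , ≤-trans (s≤s (m≤m+n p m)) (≤-reflexive (sym (+-suc p m))) , cliff⇒move (≤-trans h1 (<⇒≤ h2)) cL
  ... | inj₂ (inj₁ e) = i , suc p , ≤-refl , ≤-trans (s≤s (m≤m+n p m)) (≤-reflexive (sym (+-suc p m))) , h1 , <-trans h2 ≤-refl ,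
        ≤-reflexive (trans (cong suc e) eP) ,
        (λ j i<j j<sp → trans (cong suc (eqs j i<j (≤-pred j<sp))) eP , trans e (sym (eqs j i<j (≤-pred j<sp))))
  ... | inj₂ (inj₂ e) with m
  ...   | zero = ⊥-elim (<-irrefl refl (≤-trans bd' (≤-reflexive (sym e))))
    where
    bd' : suc (f (suc p)) ≤ f p
    bd' = subst (λ z → suc (f z) ≤ f p) (+-comm p 1) bd
  ...   | suc m' = subst (MoveBetween f i) (sym (+-suc p (suc m'))) (from-plateau m' i (suc p) h1 (<-trans h2 ≤-refl) (trans (cong suc e) eP) eqs' bd'')
    where
    eqs' : ∀ j → i < j → j ≤ suc p → f j ≡ f (suc p)
    eqs' j i<j j≤sp with m≤n⇒m<n∨m≡n j≤sp
    ... | inj₁ lt = trans (eqs j i<j (≤-pred lt)) (sym e)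
    ... | inj₂ refl = refl
    bd'' : suc (f (suc p + suc m')) ≤ f (suc p)
    bd'' = subst₂ (λ z w → suc (f z) ≤ w) (+-suc p (suc m')) (sym e) bd

  from : ∀ m i → 1 ≤ i → suc (suc (f (i + suc m))) ≤ f i → MoveBetween f i (i + suc m)
  from m i h1 bd with drop-cases (f i) (f (suc i)) (ni i h1)
  ... | inj₁ cL = i , suc i , ≤-refl , ≤-trans (s≤s (m≤m+n i m)) (≤-reflexive (sym (+-suc i m))) , cliff⇒move h1 cL
  from zero i h1 bd | inj₂ (inj₁ e) = ⊥-elim (<-irrefl refl (≤-trans (subst (λ z → suc (suc (f z)) ≤ f i) (+-comm i 1) bd) (≤-reflexive (sym e))))
  from (suc m) i h1 bd | inj₂ (inj₁ e) =
    subst (MoveBetween f i) (sym (+-suc i (suc m))) (from-plateau m i (suc i) h1 ≤-refl e (λ j i<j j≤si → cong f (≤-antisym j≤si i<j)) bd')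
    where
    bd' : suc (f (suc i + suc m)) ≤ f (suc i)
    bd' = ≤-pred (subst₂ (λ z w → suc (suc (f z)) ≤ w) (+-suc i (suc m)) (sym e) bd)
  from zero i h1 bd | inj₂ (inj₂ e) = ⊥-elim (<-irrefl refl (≤-trans (subst (λ z → suc (suc (f z)) ≤ f i) (+-comm i 1) bd) (≤-trans (≤-reflexive (sym e)) (n≤1+n _))))
  from (suc m) i h1 bd | inj₂ (inj₂ e) with from m (suc i) (s≤s z≤n) (subst₂ (λ z w → suc (suc (f z)) ≤ w) (+-suc i (suc m)) (sym e) bd)
  ... | i' , k' , le1 , le2 , mc = i' , k' , <⇒≤ le1 , ≤-trans le2 (≤-reflexive (sym (+-suc i (suc m)))) , mc

move-between : ∀ {f} → NonIncreasingFn f → ∀ {i k} → 1 ≤ i → i < k → suc (suc (f k)) ≤ f i → MoveBetween f i k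
move-between {f} ni {i} h1 lt bd with m≤n⇒∃[o]m+o≡n lt
... | o , eq = subst (MoveBetween f i) (trans (+-suc i o) eq)
                 (FindMove.from f ni o i h1 (subst (λ z → suc (suc (f z)) ≤ f i) (sym (trans (+-suc i o) eq)) bd))

move-after : ∀ {f} → NonIncreasingFn f → ∀ {i K} → 1 ≤ i → i < K → f K ≡ 0 → 2 ≤ f i → Σ ℕ λ i' → Σ ℕ λ k' → i ≤ i' × Move f i' k'
move-after {f} ni {i} h1 lt fK fi with move-between ni h1 lt (subst (λ z → 2 + z ≤ f i) (sym fK) fi)
... | i' , k' , a , _ , c = i' , k' , a , c

module Least (P : ℕ → Set) (P? : ∀ j → Dec (P j)) where
  below : ∀ j → (∀ t → t < j → ¬ P t) ⊎ (Σ ℕ λ i → P i × i < j × (∀ t → t < i → ¬ P t))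
  below zero = inj₁ (λ t ())
  below (suc j) with below j
  ... | inj₂ (i , pi , lt , mn) = inj₂ (i , pi , <-trans lt ≤-refl , mn)
  ... | inj₁ none with P? j
  ...   | yes pj = inj₂ (j , pj , ≤-refl , none)
  ...   | no npj = inj₁ none′
    where
    none′ : ∀ t → t < suc j → ¬ P t
    none′ t t<sj with m≤n⇒m<n∨m≡n (≤-pred t<sj)
    ... | inj₁ t<j = none t t<j
    ... | inj₂ refl = npj

  least : ∀ j → P j → Σ ℕ λ i → P i × i ≤ j × (∀ t → t < i → ¬ P t)
  least j pj with below (suc j)
  ... | inj₁ none = ⊥-elim (none j ≤-refl pj)
  ... | inj₂ (i , pi , lt , mn) = i , pi , ≤-pred lt , mn

constant-from : ∀ {f : ℕ → ℕ} {s q} → (∀ t → s ≤ t → t < q → f (suc t) ≡ f t) → ∀ j → s ≤ j → j ≤ q → f j ≡ f s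
constant-from {f} {s} {q} h zero s≤j j≤q with s≤j
... | z≤n = refl
constant-from {f} {s} {q} h (suc j) s≤j j≤q with m≤n⇒m<n∨m≡n s≤j
... | inj₂ refl = refl
... | inj₁ lt = trans (h j (≤-pred lt) j≤q) (constant-from h j (≤-pred lt) (≤-trans (n≤1+n j) j≤q))

move⇒2≤top : ∀ {f} → NonIncreasingFn f → ∀ {i k} → Move f i k → 2 ≤ f 1
move⇒2≤top ni (1≤i , _ , c , _) = ≤-trans (≤-trans (s≤s (s≤s z≤n)) c) (antitone ni ≤-refl 1≤i)

first-drop : ∀ {N} (x : Vec ℕ N) → NonIncreasing x → 1 ≤ get x 1
           → Σ ℕ λ r → 1 ≤ r × get x (suc r) < get x r × (∀ j → 1 ≤ j → j ≤ r → get x j ≡ get x 1)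
first-drop {N} x ni x1 with Least.below (λ j → 1 ≤ j × get x (suc j) < get x j) (λ j → (1 ≤? j) ×-dec (get x (suc j) <? get x j)) (suc N)
... | inj₁ none = ⊥-elim (<-irrefl (trans (sym (get-beyond x (suc N) ≤-refl)) (flat (suc N) (s≤s z≤n) ≤-refl)) x1)
  where
  flat : ∀ j → 1 ≤ j → j ≤ suc N → get x j ≡ get x 1
  flat = constant-from (λ t a b → ≤-antisym (ni t a) (≮⇒≥ λ lt → none t b (a , lt)))
... | inj₂ (r , (1≤r , drop) , _ , before) = r , 1≤r , drop , constant-from (λ t a b → ≤-antisym (ni t a) (≮⇒≥ λ lt → before t b (a , lt)))

-- Covers in the dominance order

incAt : ∀ {n} → ℕ → Vec ℕ n → Vec ℕ n
incAt _             []       = []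
incAt zero          (x ∷ xs) = x ∷ xs
incAt (suc zero)    (x ∷ xs) = suc x ∷ xs
incAt (suc (suc j)) (x ∷ xs) = x ∷ incAt (suc j) xs

get-decAt-same : ∀ {n} (a : Vec ℕ n) i → get (decAt i a) i ≡ pred (get a i)
get-decAt-same [] i = refl
get-decAt-same (x ∷ xs) zero = refl
get-decAt-same (x ∷ xs) (suc zero) = refl
get-decAt-same (x ∷ xs) (suc (suc i)) = get-decAt-same xs (suc i)

get-decAt-other : ∀ {n} (a : Vec ℕ n) i j → j ≢ i → get (decAt i a) j ≡ get a j
get-decAt-other [] i j _ = refl
get-decAt-other (x ∷ xs) zero j _ = refl
get-decAt-other (x ∷ xs) (suc zero) zero _ = refl
get-decAt-other (x ∷ xs) (suc zero) (suc zero) ne = ⊥-elim (ne refl)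
get-decAt-other (x ∷ xs) (suc zero) (suc (suc j)) _ = refl
get-decAt-other (x ∷ xs) (suc (suc i)) zero _ = refl
get-decAt-other (x ∷ xs) (suc (suc i)) (suc zero) _ = refl
get-decAt-other (x ∷ xs) (suc (suc i)) (suc (suc j)) ne = get-decAt-other xs (suc i) (suc j) (λ e → ne (cong suc e))

get-incAt-same : ∀ {n} (a : Vec ℕ n) i → 1 ≤ i → i ≤ n → get (incAt i a) i ≡ suc (get a i)
get-incAt-same (x ∷ xs) (suc zero) _ _ = refl
get-incAt-same (x ∷ xs) (suc (suc i)) _ (s≤s le) = get-incAt-same xs (suc i) (s≤s z≤n) le

get-incAt-other : ∀ {n} (a : Vec ℕ n) i j → j ≢ i → get (incAt i a) j ≡ get a j
get-incAt-other [] i j _ = refl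
get-incAt-other (x ∷ xs) zero j _ = refl
get-incAt-other (x ∷ xs) (suc zero) zero _ = refl
get-incAt-other (x ∷ xs) (suc zero) (suc zero) ne = ⊥-elim (ne refl)
get-incAt-other (x ∷ xs) (suc zero) (suc (suc j)) _ = refl
get-incAt-other (x ∷ xs) (suc (suc i)) zero _ = refl
get-incAt-other (x ∷ xs) (suc (suc i)) (suc zero) _ = refl
get-incAt-other (x ∷ xs) (suc (suc i)) (suc (suc j)) ne = get-incAt-other xs (suc i) (suc j) (λ e → ne (cong suc e))

psum-decAt-< : ∀ {n} (a : Vec ℕ n) i j → j < i → psum (decAt i a) j ≡ psum a j
psum-decAt-< a i zero _ = refl
psum-decAt-< a i (suc j) lt = cong₂ _+_ (psum-decAt-< a i j (<-trans (n<1+n j) lt)) (get-decAt-other a i (suc j) (<⇒≢ lt))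

psum-decAt-≥ : ∀ {n} (a : Vec ℕ n) i j → 1 ≤ i → 1 ≤ get a i → i ≤ j → suc (psum (decAt i a) j) ≡ psum a j
psum-decAt-≥ a i zero h1 h2 le = ⊥-elim (<⇒≱ h1 le)
psum-decAt-≥ a i (suc j) h1 h2 le with m≤n⇒m<n∨m≡n le
... | inj₁ (s≤s i≤j) = trans (cong (_+ get (decAt i a) (suc j)) (psum-decAt-≥ a i j h1 h2 i≤j)) (cong (psum a j +_) (get-decAt-other a i (suc j) (>⇒≢ (s≤s i≤j))))
... | inj₂ refl = trans (sym (+-suc _ _)) (cong₂ _+_ (psum-decAt-< a (suc j) j ≤-refl) (trans (cong suc (get-decAt-same a (suc j))) (suc-pred _ {{>-nonZero h2}})))

psum-incAt-< : ∀ {n} (a : Vec ℕ n) i j → j < i → psum (incAt i a) j ≡ psum a j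
psum-incAt-< a i zero _ = refl
psum-incAt-< a i (suc j) lt = cong₂ _+_ (psum-incAt-< a i j (<-trans (n<1+n j) lt)) (get-incAt-other a i (suc j) (<⇒≢ lt))

psum-incAt-≥ : ∀ {n} (a : Vec ℕ n) i j → 1 ≤ i → i ≤ n → i ≤ j → psum (incAt i a) j ≡ suc (psum a j)
psum-incAt-≥ a i zero h1 h2 le = ⊥-elim (<⇒≱ h1 le)
psum-incAt-≥ a i (suc j) h1 h2 le with m≤n⇒m<n∨m≡n le
... | inj₁ (s≤s i≤j) = cong₂ _+_ (psum-incAt-≥ a i j h1 h2 i≤j) (get-incAt-other a i (suc j) (>⇒≢ (s≤s i≤j)))
... | inj₂ refl = trans (cong₂ _+_ (psum-incAt-< a (suc j) j ≤-refl) (get-incAt-same a (suc j) h1 h2)) (+-suc _ _)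

locate : ∀ j i k → (j < i) ⊎ ((i ≤ j × j < k) ⊎ (k ≤ j))
locate j i k with j <? i | j <? k
... | yes lt | _ = inj₁ lt
... | no nlt | yes lt = inj₂ (inj₁ (≮⇒≥ nlt , lt))
... | no _ | no nlt = inj₂ (inj₂ (≮⇒≥ nlt))

lower : ∀ {n} → Vec ℕ n → ℕ → ℕ → Vec ℕ n
lower a i k = incAt k (decAt i a)

module Lower {n} (a : Vec ℕ n) {i k} (mv : Move (get a) i k) (k≤n : k ≤ n) where
  private
    A L : ℕ → ℕ
    A = get a
    L = get (lower a i k)
    1≤i : 1 ≤ i
    1≤i = proj₁ mv
    i<k : i < k
    i<k = proj₁ (proj₂ mv)
    1≤k : 1 ≤ k
    1≤k = ≤-trans 1≤i (<⇒≤ i<k)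
    1≤ai : 1 ≤ A i
    1≤ai = move-source-pos mv

  psum-lower-< : ∀ j → j < i → psum (lower a i k) j ≡ psum a j
  psum-lower-< j lt = trans (psum-incAt-< (decAt i a) k j (<-trans lt i<k)) (psum-decAt-< a i j lt)

  psum-lower-mid : ∀ j → i ≤ j → j < k → suc (psum (lower a i k) j) ≡ psum a j
  psum-lower-mid j le lt = trans (cong suc (psum-incAt-< (decAt i a) k j lt)) (psum-decAt-≥ a i j 1≤i 1≤ai le)

  psum-lower-≥ : ∀ j → k ≤ j → psum (lower a i k) j ≡ psum a j
  psum-lower-≥ j le = trans (psum-incAt-≥ (decAt i a) k j 1≤k k≤n le) (psum-decAt-≥ a i j 1≤i 1≤ai (≤-trans (<⇒≤ i<k) le))

  get-lower-source : suc (L i) ≡ A i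
  get-lower-source = trans (cong suc (trans (get-incAt-other (decAt i a) k i (<⇒≢ i<k)) (get-decAt-same a i))) (suc-pred _ {{>-nonZero 1≤ai}})

  get-lower-target : L k ≡ suc (A k)
  get-lower-target = trans (get-incAt-same (decAt i a) k 1≤k k≤n) (cong suc (get-decAt-other a i k (>⇒≢ i<k)))

  get-lower-other : ∀ j → j ≢ i → j ≢ k → L j ≡ A j
  get-lower-other j ne1 ne2 = trans (get-incAt-other (decAt i a) k j ne2) (get-decAt-other a i j ne1)

  lower-sum : sum (lower a i k) ≡ sum a
  lower-sum = trans (sym (psum-sum (lower a i k) n ≤-refl)) (trans (psum-lower-≥ n k≤n) (psum-sum a n ≤-refl))

  lower-nonIncreasing : NonIncreasing a → NonIncreasing (lower a i k)
  lower-nonIncreasing ni t 1≤t with t ≟ i | t ≟ k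
  ... | yes refl | yes refl = ⊥-elim (<-irrefl refl i<k)
  ... | yes refl | no _ = source-step
    where
    source-step : L (suc t) ≤ L t
    source-step with suc t ≟ k
    ... | yes e = ≤-pred (begin
      suc (L (suc t))   ≡⟨ cong (λ z → suc (L z)) e ⟩
      suc (L k)         ≡⟨ cong suc get-lower-target ⟩
      suc (suc (A k))   ≤⟨ proj₁ (proj₂ (proj₂ mv)) ⟩
      A t               ≡⟨ sym get-lower-source ⟩
      suc (L t)         ∎)
      where open ≤-Reasoning
    ... | no st≢k = ≤-reflexive (suc-injective (begin
      suc (L (suc t))   ≡⟨ cong suc (get-lower-other (suc t) (>⇒≢ ≤-refl) st≢k) ⟩
      suc (A (suc t))   ≡⟨ proj₁ (proj₂ (proj₂ (proj₂ mv)) (suc t) ≤-refl (≤∧≢⇒< i<k st≢k)) ⟩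
      A t               ≡⟨ sym get-lower-source ⟩
      suc (L t)         ∎))
      where open ≡-Reasoning
  ... | no t≢i | yes refl = begin
    L (suc t)   ≡⟨ get-lower-other (suc t) (>⇒≢ (<-trans i<k ≤-refl)) (>⇒≢ ≤-refl) ⟩
    A (suc t)   ≤⟨ ni t 1≤t ⟩
    A t         ≤⟨ n≤1+n _ ⟩
    suc (A t)   ≡⟨ sym get-lower-target ⟩
    L t         ∎
    where open ≤-Reasoning
  ... | no t≢i | no t≢k with suc t ≟ i | suc t ≟ k
  ...   | yes e | _ = begin
    L (suc t)   ≡⟨ cong L e ⟩
    L i         ≤⟨ n≤1+n _ ⟩
    suc (L i)   ≡⟨ get-lower-source ⟩
    A i         ≡⟨ cong A (sym e) ⟩
    A (suc t)   ≤⟨ ni t 1≤t ⟩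
    A t         ≡⟨ sym (get-lower-other t t≢i t≢k) ⟩
    L t         ∎
    where open ≤-Reasoning
  ...   | no _ | yes e = ≤-reflexive (begin
    L (suc t)   ≡⟨ cong L e ⟩
    L k         ≡⟨ get-lower-target ⟩
    suc (A k)   ≡⟨ proj₂ (proj₂ (proj₂ (proj₂ mv)) t i<t (subst (t <_) e ≤-refl)) ⟩
    A t         ≡⟨ sym (get-lower-other t t≢i t≢k) ⟩
    L t         ∎)
    where
    open ≡-Reasoning
    i<t : i < t
    i<t = ≤∧≢⇒< (≤-pred (subst (i <_) (sym e) i<k)) (λ e' → t≢i (sym e'))
  ...   | no st≢i | no st≢k = begin
    L (suc t)   ≡⟨ get-lower-other (suc t) st≢i st≢k ⟩
    A (suc t)   ≤⟨ ni t 1≤t ⟩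
    A t         ≡⟨ sym (get-lower-other t t≢i t≢k) ⟩
    L t         ∎
    where open ≤-Reasoning

  lower-partition : ∀ {m} → IsPartition m a → IsPartition m (lower a i k)
  lower-partition (ni , s) = lower-nonIncreasing ni , trans lower-sum s

  lower-below : Dominates a (lower a i k)
  lower-below j _ with locate j i k
  ... | inj₁ lt = ≤-reflexive (psum-lower-< j lt)
  ... | inj₂ (inj₁ (le , lt)) = ≤-trans (n≤1+n _) (≤-reflexive (psum-lower-mid j le lt))
  ... | inj₂ (inj₂ le) = ≤-reflexive (psum-lower-≥ j le)

  lower-≢ : lower a i k ≢ a
  lower-≢ e = <-irrefl refl (≤-reflexive (subst (λ z → suc (psum z i) ≡ psum a i) e (psum-lower-mid i ≤-refl i<k)))

≤psum : ∀ {N} (x : Vec ℕ N) → (∀ j → 1 ≤ j → j ≤ N → 1 ≤ get x j) → ∀ J → J ≤ N → J ≤ psum x J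
≤psum x nonempty zero _ = z≤n
≤psum x nonempty (suc J) le = ≤-trans (≤-reflexive (+-comm 1 J)) (+-mono-≤ (≤psum x nonempty J (≤-trans (n≤1+n J) le)) (nonempty (suc J) (s≤s z≤n) le))

suc≤psum : ∀ {N} (x : Vec ℕ N) i → (∀ j → 1 ≤ j → j ≤ N → 1 ≤ get x j) → 1 ≤ i → 2 ≤ get x i
         → ∀ J → J ≤ N → i ≤ J → suc J ≤ psum x J
suc≤psum x i nonempty h1 h2 zero _ le = ⊥-elim (<⇒≱ h1 le)
suc≤psum x i nonempty h1 h2 (suc J) JN le with m≤n⇒m<n∨m≡n le
... | inj₁ lt = ≤-trans (s≤s (suc≤psum x i nonempty h1 h2 J (≤-trans (n≤1+n J) JN) (≤-pred lt)))
                        (≤-trans (≤-reflexive (+-comm 1 _)) (+-monoʳ-≤ (psum x J) (nonempty (suc J) (s≤s z≤n) JN)))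
... | inj₂ refl = ≤-trans (≤-reflexive (+-comm 2 J)) (+-mono-≤ (≤psum x nonempty J (≤-trans (n≤1+n J) JN)) h2)

-- If k exceeded N, the staircase would make every row up to N nonempty and row i at least 2 high, forcing the sum above N.
move-bound : ∀ {N} (x : Vec ℕ N) → IsPartition N x → ∀ {i k} → Move (get x) i k → k ≤ N
move-bound {N} x (ni , sx) {i} {k} (h1 , h2 , c , bt) with k ≤? N
... | yes le = le
... | no k≰N = ⊥-elim (<-irrefl refl (begin-strict
  N                <⟨ suc≤psum x i nonempty h1 (≤-trans (s≤s (s≤s z≤n)) c) N ≤-refl i≤N ⟩
  psum x N         ≡⟨ psum-sum x N ≤-refl ⟩
  sum x            ≡⟨ sx ⟩
  N                ∎))
  where
  open ≤-Reasoning
  N<k : N < k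
  N<k = ≰⇒> k≰N
  i≤N : i ≤ N
  i≤N with i ≤? N
  ... | yes le = le
  ... | no i≰N with ≤-trans c (≤-reflexive (get-beyond x i (≰⇒> i≰N)))
  ...   | ()
  1≤xN : 1 ≤ get x N
  1≤xN with m≤n⇒m<n∨m≡n i≤N
  ... | inj₂ refl = ≤-trans (s≤s z≤n) c
  ... | inj₁ lt = ≤-reflexive (trans (cong suc (sym (get-beyond x k N<k))) (proj₂ (bt N lt N<k)))
  nonempty : ∀ j → 1 ≤ j → j ≤ N → 1 ≤ get x j
  nonempty j h le = ≤-trans 1≤xN (antitone ni h le)

move⇒last-empty : ∀ {N} (x : Vec ℕ N) → IsPartition N x → ∀ {i k} → Move (get x) i k → get x N ≡ 0
move⇒last-empty {N} x px@(ni , sx) {i} mv@(1≤i , i<k , c , _) = n≤0⇒n≡0 (≮⇒≥ λ 0<xN → <-irrefl refl (begin-strict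
  N          <⟨ suc≤psum x i (λ j h le → ≤-trans 0<xN (antitone ni h le)) 1≤i (≤-trans (s≤s (s≤s z≤n)) c) N ≤-refl
                  (<⇒≤ (<-≤-trans i<k (move-bound x px mv))) ⟩
  psum x N   ≡⟨ psum-sum x N ≤-refl ⟩
  sum x      ≡⟨ sx ⟩
  N          ∎))
  where open ≤-Reasoning

psum-agree-beyond : ∀ {n} (a b : Vec ℕ n) → IsPartition n a → IsPartition n b → ∀ j → n ≤ j → psum b j ≡ psum a j
psum-agree-beyond a b (_ , sa) (_ , sb) j n≤j = trans (psum-sum b j n≤j) (trans sb (sym (trans (psum-sum a j n≤j) sa)))

excess-starts : ∀ {n} (a b : Vec ℕ n) j → psum b j ≡ psum a j → psum b (suc j) < psum a (suc j) → get b (suc j) < get a (suc j)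
excess-starts a b j eq lt = +-cancelˡ-< (psum a j) _ _ (subst (λ z → z + get b (suc j) < psum a j + get a (suc j)) eq lt)

excess-ends : ∀ {n} (a b : Vec ℕ n) j → psum b j < psum a j → psum b (suc j) ≡ psum a (suc j) → get a (suc j) < get b (suc j)
excess-ends a b j lt eq = ≰⇒> λ bj≤aj → <-irrefl eq (+-mono-<-≤ lt bj≤aj)

ExcessInterval : ∀ {n} → Vec ℕ n → Vec ℕ n → Set
ExcessInterval {n} a b = Σ ℕ λ i → Σ ℕ λ k → 1 ≤ i × i < k × k ≤ n
  × (∀ t → i ≤ t → t < k → psum b t < psum a t) × suc (suc (get a k)) ≤ get a i

-- i is the first index where the prefix sums of a exceed those of b, k the next one where they agree again;
-- then a_i > b_i ≥ b_k > a_k.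
excess-interval : ∀ {n} (a b : Vec ℕ n) → IsPartition n a → IsPartition n b → StrictlyBelow b a → ExcessInterval a b
excess-interval {n} a b pa pb (dom , ne) with Least.below (λ j → psum b j < psum a j) (λ j → psum b j <? psum a j) (suc n)
... | inj₁ none = ⊥-elim (ne (psum-ext b a agree))
  where
  agree : ∀ j → 1 ≤ j → psum b j ≡ psum a j
  agree j h with j ≤? n
  ... | yes j≤n = ≤-antisym (dom j h) (≮⇒≥ (none j (s≤s j≤n)))
  ... | no j≰n = psum-agree-beyond a b pa pb j (<⇒≤ (≰⇒> j≰n))
... | inj₂ (zero , () , _)
... | inj₂ (suc i₀ , Pi , i<sn , before-i) = i , k , 1≤i , i<k , k≤n , inside , ak+2≤ai
  where
  i : ℕ
  i = suc i₀
  1≤i : 1 ≤ i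
  1≤i = s≤s z≤n
  agree-at-n : psum b n ≡ psum a n
  agree-at-n = psum-agree-beyond a b pa pb n ≤-refl
  i<n : i < n
  i<n = ≤∧≢⇒< (≤-pred i<sn) (λ e → <-irrefl (subst (λ z → psum b z ≡ psum a z) (sym e) agree-at-n) Pi)
  Agree : ℕ → Set
  Agree k = i < k × psum b k ≡ psum a k
  next : Σ ℕ λ k → Agree k × k ≤ n × (∀ t → t < k → ¬ Agree t)
  next = Least.least Agree (λ k → (i <? k) ×-dec (psum b k ≟ psum a k)) n (i<n , agree-at-n)
  k : ℕ
  k = proj₁ next
  i<k : i < k
  i<k = proj₁ (proj₁ (proj₂ next))
  agree-at-k : psum b k ≡ psum a k
  agree-at-k = proj₂ (proj₁ (proj₂ next))
  k≤n : k ≤ n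
  k≤n = proj₁ (proj₂ (proj₂ next))
  before-k : ∀ t → t < k → ¬ Agree t
  before-k = proj₂ (proj₂ (proj₂ next))
  inside : ∀ t → i ≤ t → t < k → psum b t < psum a t
  inside t i≤t t<k with m≤n⇒m<n∨m≡n i≤t
  ... | inj₂ refl = Pi
  ... | inj₁ i<t = ≤∧≢⇒< (dom t (≤-trans 1≤i (<⇒≤ i<t))) (λ e → before-k t t<k (i<t , e))
  agree-before-i : ∀ j → j < i → psum b j ≡ psum a j
  agree-before-i zero _ = refl
  agree-before-i (suc j) lt = ≤-antisym (dom (suc j) (s≤s z≤n)) (≮⇒≥ (before-i (suc j) lt))
  bi<ai : get b i < get a i
  bi<ai = excess-starts a b i₀ (agree-before-i i₀ ≤-refl) Pi
  excess-ends-at : ∀ k → i < k → psum b k ≡ psum a k → (∀ t → i ≤ t → t < k → psum b t < psum a t) → get a k < get b k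
  excess-ends-at (suc k′) i<k eq inside′ = excess-ends a b k′ (inside′ k′ (≤-pred i<k) ≤-refl) eq
  ak+2≤ai : suc (suc (get a k)) ≤ get a i
  ak+2≤ai = ≤-trans (s≤s (excess-ends-at k i<k agree-at-k inside)) (≤-trans (s≤s (antitone (proj₁ pb) 1≤i (<⇒≤ i<k))) bi<ai)

-- Inside the excess interval a move still leaves the prefix sums of a at least those of b.
move-toward : ∀ {n} (a b : Vec ℕ n) → IsPartition n a → IsPartition n b → StrictlyBelow b a
            → Σ ℕ λ i → Σ ℕ λ k → Move (get a) i k × Dominates (lower a i k) b
move-toward a b pa pb b<a with excess-interval a b pa pb b<a
... | i , k , 1≤i , i<k , k≤n , inside , ak+2≤ai with move-between (proj₁ pa) 1≤i i<k ak+2≤ai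
... | i' , k' , i≤i' , k'≤k , mv = i' , k' , mv , dominates
  where
  open Lower a mv (≤-trans k'≤k k≤n)
  dominates : Dominates (lower a i' k') b
  dominates j h with locate j i' k'
  ... | inj₁ lt = ≤-trans (proj₁ b<a j h) (≤-reflexive (sym (psum-lower-< j lt)))
  ... | inj₂ (inj₁ (le , lt)) = ≤-pred (≤-trans (inside j (≤-trans i≤i' le) (<-≤-trans lt k'≤k)) (≤-reflexive (sym (psum-lower-mid j le lt))))
  ... | inj₂ (inj₂ le) = ≤-trans (proj₁ b<a j h) (≤-reflexive (sym (psum-lower-≥ j le)))

-- The prefix sums drop exactly on [i, k), so dominance of lowerings forces [i', k') ⊆ [i, k); the staircase then rules out a proper inclusion.
same-move : ∀ {n} (a : Vec ℕ n) → IsPartition n a → ∀ {i k i' k'} → Move (get a) i k → Move (get a) i' k'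
          → Dominates (lower a i' k') (lower a i k) → (i' ≡ i) × (k' ≡ k)
same-move a pa {i} {k} {i'} {k'} mv@(h1 , h2 , c , bt) mv'@(h1' , h2' , c' , bt') L≤L' = i'≡i , k'≡k
  where
  module L = Lower a mv (move-bound a pa mv)
  module L' = Lower a mv' (move-bound a pa mv')
  nested : ∀ j → 1 ≤ j → i' ≤ j → j < k' → i ≤ j × j < k
  nested j hj le lt with locate j i k
  ... | inj₁ j<i = ⊥-elim (<-irrefl refl (≤-trans (s≤s (≤-trans (≤-reflexive (sym (L.psum-lower-< j j<i))) (L≤L' j hj))) (≤-reflexive (L'.psum-lower-mid j le lt))))
  ... | inj₂ (inj₁ p) = p
  ... | inj₂ (inj₂ k≤j) = ⊥-elim (<-irrefl refl (≤-trans (s≤s (≤-trans (≤-reflexive (sym (L.psum-lower-≥ j k≤j))) (L≤L' j hj))) (≤-reflexive (L'.psum-lower-mid j le lt))))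
  instance
    k'-nonZero : NonZero k'
    k'-nonZero = >-nonZero (≤-trans (s≤s z≤n) h2')
  i≤i' : i ≤ i'
  i≤i' = proj₁ (nested i' h1' ≤-refl h2')
  i'<k : i' < k
  i'<k = proj₂ (nested i' h1' ≤-refl h2')
  i'≤k'-1 : i' ≤ pred k'
  i'≤k'-1 = ≤-pred (subst (i' <_) (sym (suc-pred k')) h2')
  k'≤k : k' ≤ k
  k'≤k = subst (_≤ k) (suc-pred k') (proj₂ (nested (pred k') (≤-trans h1' i'≤k'-1) i'≤k'-1 (subst (pred k' <_) (suc-pred k') ≤-refl)))
  i'≡i : i' ≡ i
  i'≡i with m≤n⇒m<n∨m≡n i≤i'
  ... | inj₂ e = sym e
  ... | inj₁ i<i' = ⊥-elim (<-irrefl refl (≤-trans (s≤s (s≤s (antitone (proj₁ pa) (≤-trans h1' (<⇒≤ h2')) k'≤k))) (≤-trans c' (≤-reflexive (sym (proj₂ (bt i' i<i' i'<k)))))))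
  k'≡k : k' ≡ k
  k'≡k with m≤n⇒m<n∨m≡n k'≤k
  ... | inj₂ e = e
  ... | inj₁ k'<k = ⊥-elim (<-irrefl refl (≤-trans c' (≤-reflexive (trans (cong (get a) i'≡i) (sym (proj₁ (bt k' (subst (_< k') i'≡i h2') k'<k)))))))

nothing-between-lower : ∀ {n} (a : Vec ℕ n) {i k} → IsPartition n a → Move (get a) i k
                      → ∀ c → IsPartition n c → StrictlyBelow (lower a i k) c → ¬ StrictlyBelow c a
nothing-between-lower a {i} {k} pa mv c pc (L≤c , L≢c) c<a =
  L≢c (dominates-antisym (lower a i k) c (subst₂ (λ x y → Dominates (lower a x y) c) (proj₁ same) (proj₂ same) (proj₂ (proj₂ (proj₂ toward)))) L≤c)
  where
  toward : Σ ℕ λ i' → Σ ℕ λ k' → Move (get a) i' k' × Dominates (lower a i' k') c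
  toward = move-toward a c pa pc c<a
  same : (proj₁ toward ≡ i) × (proj₁ (proj₂ toward) ≡ k)
  same = same-move a pa mv (proj₁ (proj₂ (proj₂ toward))) (dominates-trans (proj₂ (proj₂ (proj₂ toward))) L≤c)

move⇒covers : ∀ {n} (a : Vec ℕ n) {i k} → IsPartition n a → Move (get a) i k → Covers n a (lower a i k)
move⇒covers a pa mv = lower-partition pa , (lower-below , lower-≢) , nothing-between-lower a pa mv
  where open Lower a mv (move-bound a pa mv)

covers⇒lower : ∀ {n} (a b : Vec ℕ n) → IsPartition n a → Covers n a b
             → Σ ℕ λ i → Σ ℕ λ k → Move (get a) i k × b ≡ lower a i k
covers⇒lower a b pa (pb , b<a , nothing-between) = i , k , mv , b≡L
  where
  toward : Σ ℕ λ i → Σ ℕ λ k → Move (get a) i k × Dominates (lower a i k) b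
  toward = move-toward a b pa pb b<a
  i k : ℕ
  i = proj₁ toward
  k = proj₁ (proj₂ toward)
  mv : Move (get a) i k
  mv = proj₁ (proj₂ (proj₂ toward))
  open Lower a mv (move-bound a pa mv)
  b≡L : b ≡ lower a i k
  b≡L = decidable-stable (≡-dec _≟_ b (lower a i k))
          (λ b≢L → nothing-between (lower a i k) (lower-partition pa) (proj₂ (proj₂ (proj₂ toward)) , b≢L) (lower-below , lower-≢))

opaque
  joinIrr⇒uniqueMove : ∀ {n} (a : Vec ℕ n) → JoinIrr n a → IsPartition n a × UniqueMove (get a)
  joinIrr⇒uniqueMove a (pa , (b , a⋗b) , unique) = pa , i , k , mv , only
    where
    covered : Σ ℕ λ i → Σ ℕ λ k → Move (get a) i k × b ≡ lower a i k
    covered = covers⇒lower a b pa a⋗b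
    i k : ℕ
    i = proj₁ covered
    k = proj₁ (proj₂ covered)
    mv : Move (get a) i k
    mv = proj₁ (proj₂ (proj₂ covered))
    only : ∀ i' k' → Move (get a) i' k' → (i' ≡ i) × (k' ≡ k)
    only i' k' mv' = same-move a pa mv mv'
      (dominates-reflexive (trans (unique (lower a i' k') b (move⇒covers a pa mv') a⋗b) (proj₂ (proj₂ (proj₂ covered)))))

  uniqueMove⇒joinIrr : ∀ {n} (a : Vec ℕ n) → IsPartition n a → UniqueMove (get a) → JoinIrr n a
  uniqueMove⇒joinIrr a pa (i , k , mv , unique) =
    pa , (lower a i k , move⇒covers a pa mv) , λ b b' a⋗b a⋗b' → trans (is-lower b a⋗b) (sym (is-lower b' a⋗b'))
    where
    is-lower : ∀ b → Covers _ a b → b ≡ lower a i k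
    is-lower b a⋗b = trans (proj₂ (proj₂ (proj₂ covered))) (cong₂ (lower a) (proj₁ same) (proj₂ same))
      where
      covered : Σ ℕ λ i → Σ ℕ λ k → Move (get a) i k × b ≡ lower a i k
      covered = covers⇒lower a b pa a⋗b
      same : (proj₁ covered ≡ i) × (proj₁ (proj₂ covered) ≡ k)
      same = unique _ _ (proj₁ (proj₂ (proj₂ covered)))

-- Adding a cell

Bump : ℕ → (ℕ → ℕ) → (ℕ → ℕ) → Set
Bump p A B = (∀ j → j ≢ p → B j ≡ A j) × (B p ≡ suc (A p))

bump-agrees-after : ∀ {p A B} → Bump p A B → ∀ {i k} → p < i → ∀ j → i ≤ j → j ≤ k → B j ≡ A j
bump-agrees-after (bo , _) p<i j i≤j _ = bo j (λ e → <-irrefl (sym e) (<-≤-trans p<i i≤j))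

bump-agrees-after′ : ∀ {p A B} → Bump p A B → ∀ {i k} → p < i → ∀ j → i ≤ j → j ≤ k → A j ≡ B j
bump-agrees-after′ bp p<i j a b = sym (bump-agrees-after bp p<i j a b)

bump-functional : ∀ {p A X Y} → Bump p A X → Bump p A Y → ∀ j → X j ≡ Y j
bump-functional {p} (bx , px) (by , py) j with j ≟ p
... | yes refl = trans px (sym py)
... | no ne = trans (bx j ne) (sym (by j ne))

bump-nonIncreasing : ∀ {p A B} → NonIncreasingFn A → Bump p A B → (∀ j → 1 ≤ j → suc j ≡ p → suc (A p) ≤ A j) → NonIncreasingFn B
bump-nonIncreasing {p} {A} {B} ni (bo , bp) h j 1≤j with j ≟ p | suc j ≟ p
... | yes refl | _ = ≤-trans (≤-reflexive (bo (suc j) (λ e → <-irrefl (sym e) ≤-refl))) (≤-trans (ni j 1≤j) (≤-trans (n≤1+n _) (≤-reflexive (sym bp))))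
... | no ne | yes refl = ≤-trans (≤-reflexive bp) (≤-trans (h j 1≤j refl) (≤-reflexive (sym (bo j ne))))
... | no ne | no ne' = ≤-trans (≤-reflexive (bo (suc j) ne')) (≤-trans (ni j 1≤j) (≤-reflexive (sym (bo j ne))))

unbump-nonIncreasing : ∀ {p A B} → NonIncreasingFn B → Bump p A B → A (suc p) < B p → NonIncreasingFn A
unbump-nonIncreasing {p} {A} {B} ni (bo , bp) h j 1≤j with j ≟ p | suc j ≟ p
... | yes refl | _ = ≤-pred (≤-trans h (≤-reflexive bp))
... | no ne | yes refl = ≤-trans (n≤1+n _) (≤-trans (≤-reflexive (sym bp)) (≤-trans (ni j 1≤j) (≤-reflexive (bo j ne))))
... | no ne | no ne' = ≤-trans (≤-reflexive (sym (bo (suc j) ne'))) (≤-trans (ni j 1≤j) (≤-reflexive (bo j ne)))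

get-∷ʳ0 : ∀ {n} (xs : Vec ℕ n) j → get (xs ∷ʳ 0) j ≡ get xs j
get-∷ʳ0 [] zero = refl
get-∷ʳ0 [] (suc zero) = refl
get-∷ʳ0 [] (suc (suc j)) = refl
get-∷ʳ0 (x ∷ xs) zero = refl
get-∷ʳ0 (x ∷ xs) (suc zero) = refl
get-∷ʳ0 (x ∷ xs) (suc (suc j)) = get-∷ʳ0 xs (suc j)

down-bump : ∀ {n} (α : Vec ℕ n) i → 1 ≤ i → i ≤ suc n → Bump i (get α) (get (down i α))
down-bump [] (suc zero) _ _ = bo , refl
  where
  bo : ∀ j → j ≢ 1 → get (1 ∷ []) j ≡ get [] j
  bo zero _ = refl
  bo (suc zero) ne = ⊥-elim (ne refl)
  bo (suc (suc j)) _ = refl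
down-bump [] (suc (suc i)) _ (s≤s ())
down-bump (x ∷ xs) (suc zero) _ _ = bo , refl
  where
  bo : ∀ j → j ≢ 1 → get (suc x ∷ (xs ∷ʳ 0)) j ≡ get (x ∷ xs) j
  bo zero _ = refl
  bo (suc zero) ne = ⊥-elim (ne refl)
  bo (suc (suc j)) _ = get-∷ʳ0 xs (suc j)
down-bump (x ∷ xs) (suc (suc i)) _ (s≤s le) with down-bump xs (suc i) (s≤s z≤n) le
... | bo' , bi' = bo , bi'
  where
  bo : ∀ j → j ≢ suc (suc i) → get (x ∷ down (suc i) xs) j ≡ get (x ∷ xs) j
  bo zero _ = refl
  bo (suc zero) _ = refl
  bo (suc (suc j)) ne = bo' (suc j) (λ e → ne (cong suc e))

psum-bump : ∀ {n m} (x : Vec ℕ n) (y : Vec ℕ m) p → Bump p (get x) (get y) → 1 ≤ p → ∀ J → p ≤ J → psum y J ≡ suc (psum x J)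
psum-bump x y p (bo , bp) h zero le = ⊥-elim (<⇒≱ h le)
psum-bump x y p bmp@(bo , bp) h (suc J) le with m≤n⇒m<n∨m≡n le
... | inj₁ lt = trans (cong₂ _+_ (psum-bump x y p bmp h J (≤-pred lt)) (bo (suc J) (λ e → <-irrefl (sym e) lt))) refl
... | inj₂ refl = trans (cong₂ _+_ (psum-cong y x J (λ j a b → bo j (λ e → <-irrefl e (s≤s b)))) bp) (+-suc _ _)

sum-down : ∀ {n} (α : Vec ℕ n) i → 1 ≤ i → i ≤ suc n → sum (down i α) ≡ suc (sum α)
sum-down {n} α i h le = trans (sym (psum-sum (down i α) (suc n) ≤-refl)) (trans (psum-bump α (down i α) i (down-bump α i h le) h (suc n) le) (cong suc (psum-sum α (suc n) (n≤1+n n))))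

dropLast : ∀ {n} → Vec ℕ (suc n) → Vec ℕ n
dropLast (x ∷ []) = []
dropLast (x ∷ y ∷ ys) = x ∷ dropLast (y ∷ ys)

get-dropLast : ∀ {n} (v : Vec ℕ (suc n)) j → j ≤ n → get (dropLast v) j ≡ get v j
get-dropLast (x ∷ []) zero _ = refl
get-dropLast (x ∷ y ∷ ys) zero _ = refl
get-dropLast (x ∷ y ∷ ys) (suc zero) _ = refl
get-dropLast (x ∷ y ∷ ys) (suc (suc j)) (s≤s le) = get-dropLast (y ∷ ys) (suc j) le

undown : ∀ {n} (β : Vec ℕ (suc n)) → IsPartition (suc n) β → ∀ {p} → 1 ≤ p → p ≤ n
       → get β (suc p) < get β p → get β (suc n) ≡ 0
       → Σ (Vec ℕ n) λ α → IsPartition n α × Bump p (get α) (get β) × down p α ≡ β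
undown {n} β (niβ , sβ) {p} 1≤p p≤n drop last = α , (niα , sα) , bump , down≡β
  where
  α : Vec ℕ n
  α = dropLast (decAt p β)
  others : ∀ j → j ≢ p → get β j ≡ get α j
  others j ne with j ≤? n
  ... | yes le = sym (trans (get-dropLast (decAt p β) j le) (get-decAt-other β p j ne))
  ... | no nle with m≤n⇒m<n∨m≡n (≰⇒> nle)
  ...   | inj₁ lt = trans (get-beyond β j lt) (sym (get-beyond α j (<-trans (n<1+n n) lt)))
  ...   | inj₂ refl = trans last (sym (get-beyond α (suc n) ≤-refl))
  bump : Bump p (get α) (get β)
  bump = others , trans (sym (suc-pred _ {{>-nonZero (≤-trans (s≤s z≤n) drop)}}))
                        (cong suc (sym (trans (get-dropLast (decAt p β) p p≤n) (get-decAt-same β p))))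
  down≡β : down p α ≡ β
  down≡β = get-ext (down p α) β (λ j _ → bump-functional (down-bump α p 1≤p (≤-trans p≤n (n≤1+n n))) bump j)
  niα : NonIncreasing α
  niα = unbump-nonIncreasing niβ bump (≤-trans (s≤s (≤-reflexive (sym (others (suc p) (λ e → <-irrefl (sym e) ≤-refl))))) drop)
  sα : sum α ≡ n
  sα = suc-injective (begin
    suc (sum α)             ≡⟨ cong suc (sym (psum-sum α (suc n) (n≤1+n n))) ⟩
    suc (psum α (suc n))    ≡⟨ sym (psum-bump α β p bump 1≤p (suc n) (≤-trans p≤n (n≤1+n n))) ⟩
    psum β (suc n)          ≡⟨ psum-sum β (suc n) ≤-refl ⟩
    sum β                   ≡⟨ sβ ⟩
    suc n                   ∎)
    where open ≡-Reasoning

down-joinIrr : ∀ {n} (α : Vec ℕ n) p → JoinIrr n α → 1 ≤ p → p ≤ suc n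
       → (∀ j → 1 ≤ j → suc j ≡ p → suc (get α p) ≤ get α j)
       → (NonIncreasingFn (get α) → UniqueMove (get α) → Bump p (get α) (get (down p α)) → UniqueMove (get (down p α)))
       → JoinIrr (suc n) (down p α)
down-joinIrr {n} α p ji h1 h2 hni f with joinIrr⇒uniqueMove α ji
... | (niA , sA) , um = uniqueMove⇒joinIrr (down p α) (bump-nonIncreasing niA bp hni , trans (sum-down α p h1 h2) (cong suc sA)) (f niA um bp)
  where
  bp : Bump p (get α) (get (down p α))
  bp = down-bump α p h1 h2

bump-cliff : ∀ {A B} → UniqueMove A → suc (suc (A 2)) ≤ A 1 → Bump 1 A B → UniqueMove B
bump-cliff {A} {B} (i0 , k0 , mv0 , un0) c bp@(bo , b1) = 1 , 2 , mvB , un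
  where
  B2 : B 2 ≡ A 2
  B2 = bo 2 (λ ())
  mvA : Move A 1 2
  mvA = cliff⇒move (s≤s z≤n) c
  mvB : Move B 1 2
  mvB = cliff⇒move (s≤s z≤n) (≤-trans (≤-reflexive (cong (λ z → suc (suc z)) B2)) (≤-trans c (≤-trans (n≤1+n _) (≤-reflexive (sym b1)))))
  un : ∀ i k → Move B i k → (i ≡ 1) × (k ≡ 2)
  un i k mv@(h1 , h2 , cc , bt) with 1≤⇒≡1∨≥2 h1
  ... | inj₂ 2≤i = ⊥-elim (<-irrefl (sym (trans (proj₁ (un0 i k (move-cong (bump-agrees-after bp 2≤i) mv))) (sym (proj₁ (un0 1 2 mvA))))) 2≤i)
  ... | inj₁ refl with m≤n⇒m<n∨m≡n h2
  ...   | inj₂ e = refl , sym e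
  ...   | inj₁ 2<k = ⊥-elim (<-irrefl refl (≤-trans (n≤1+n _) (≤-trans c (≤-reflexive (sym (suc-injective (trans (trans (cong suc (sym B2)) (proj₁ (bt 2 ≤-refl 2<k))) b1)))))))

bump-nonSlipPlateau : ∀ {A B} → NonIncreasingFn A → UniqueMove A → ∀ k0 → 2 ≤ k0 → (∀ j → 1 ≤ j → j ≤ k0 → A j ≡ A 1) → suc (suc (A (suc k0))) ≤ A k0 → Bump 1 A B → UniqueMove B
bump-nonSlipPlateau {A} {B} ni (i0 , k1 , mv0 , un0) k0 2≤k0 pl c bp@(bo , b1) = k0 , suc k0 , mvB , un
  where
  mvA : Move A k0 (suc k0)
  mvA = cliff⇒move (≤-trans (s≤s z≤n) 2≤k0) c
  mvB : Move B k0 (suc k0)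
  mvB = move-cong (bump-agrees-after′ bp 2≤k0) mvA
  un : ∀ i k → Move B i k → (i ≡ k0) × (k ≡ suc k0)
  un i k mv@(h1 , h2 , cc , bt) with 1≤⇒≡1∨≥2 h1
  ... | inj₂ 2≤i = let e1' = un0 i k (move-cong (bump-agrees-after bp 2≤i) mv) ; e2' = un0 k0 (suc k0) mvA in
                   trans (proj₁ e1') (sym (proj₁ e2')) , trans (proj₂ e1') (sym (proj₂ e2'))
  ... | inj₁ refl with k ≤? k0
  ...   | yes k≤k0 = ⊥-elim (<-irrefl refl (≤-trans (s≤s (s≤s (≤-reflexive (sym (trans (bo k (λ e → <-irrefl (sym e) h2)) (pl k (≤-trans (s≤s z≤n) h2) k≤k0)))))) (≤-trans cc (≤-reflexive b1))))
  ...   | no k≰k0 = ⊥-elim (<-irrefl refl (≤-trans c t1))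
    where
    k0<k : k0 < k
    k0<k = ≰⇒> k≰k0
    bk0 : suc (B k) ≡ A k0
    bk0 = trans (proj₂ (bt k0 2≤k0 k0<k)) (bo k0 (λ e → <-irrefl (sym e) 2≤k0))
    bk : B k ≡ A k
    bk = bo k (λ e → <-irrefl (sym e) h2)
    t1 : A k0 ≤ suc (A (suc k0))
    t1 = ≤-trans (≤-reflexive (trans (sym bk0) (cong suc bk))) (s≤s (antitone ni (s≤s z≤n) k0<k))

module BumpPlateauEnd {A B : ℕ → ℕ} {q v : ℕ} (1≤q : 1 ≤ q) (A-plateau : ∀ j → 1 ≤ j → j ≤ q → A j ≡ suc v)
                      (A-after : A (suc q) ≡ v) (bump : Bump (suc q) A B) where
  B-end : B (suc q) ≡ suc v
  B-end = trans (proj₂ bump) (cong suc A-after)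

  B-plateau : ∀ j → 1 ≤ j → j ≤ suc q → B j ≡ suc v
  B-plateau j h le with m≤n⇒m<n∨m≡n le
  ... | inj₂ refl = B-end
  ... | inj₁ lt = trans (proj₁ bump j (λ e → <-irrefl e lt)) (A-plateau j h (≤-pred lt))

  B≡A-beyond : ∀ j → suc (suc q) ≤ j → B j ≡ A j
  B≡A-beyond j le = proj₁ bump j (λ e → <-irrefl (sym e) le)

  A-q : A q ≡ suc v
  A-q = A-plateau q 1≤q ≤-refl

  B-no-move-on-plateau : ∀ i k → 1 ≤ i → i ≤ q → ¬ Move B i k
  B-no-move-on-plateau i k h le = no-move-at-flat (trans (B-plateau (suc i) (s≤s z≤n) (s≤s le)) (sym (B-plateau i h (≤-trans le (n≤1+n q)))))

  A-no-move-on-plateau : ∀ i k → 1 ≤ i → i < q → ¬ Move A i k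
  A-no-move-on-plateau i k h lt = no-move-at-flat (trans (A-plateau (suc i) (s≤s z≤n) lt) (sym (A-plateau i h (<⇒≤ lt))))

  A-move-from-q : ∀ k → suc q < k → (∀ j → suc q < j → j < k → A j ≡ v) → suc (A k) ≡ v → Move A q k
  A-move-from-q k lt flat ak = 1≤q , <-trans ≤-refl lt , ≤-reflexive (trans (cong suc ak) (sym A-q)) , stair
    where
    stair : Staircase A q k
    stair j q<j j<k with m≤n⇒m<n∨m≡n q<j
    ... | inj₂ refl = trans (cong suc A-after) (sym A-q) , trans ak (sym A-after)
    ... | inj₁ sq<j = trans (cong suc (flat j sq<j j<k)) (sym A-q) , trans ak (sym (flat j sq<j j<k))

  B-move-from-end : ∀ k → suc q < k → (∀ j → suc q < j → j < k → A j ≡ v) → suc (A k) ≡ v → Move B (suc q) k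
  B-move-from-end k lt flat ak =
    s≤s z≤n , lt , ≤-reflexive (trans (cong (λ z → suc (suc z)) (B≡A-beyond k lt)) (trans (cong suc ak) (sym B-end))) ,
    λ j a b → trans (cong suc (trans (B≡A-beyond j a) (flat j a b))) (sym B-end) , trans (cong suc (B≡A-beyond k lt)) (trans ak (sym (trans (B≡A-beyond j a) (flat j a b))))

  B-short-move : suc (suc (A (suc (suc q)))) ≤ suc v → Move B (suc q) (suc (suc q))
  B-short-move c = cliff⇒move (s≤s z≤n) (≤-trans (≤-reflexive (cong (λ z → suc (suc z)) (B≡A-beyond _ ≤-refl))) (≤-trans c (≤-reflexive (sym B-end))))

  B-moves : ∀ i k → Move B i k
          → (suc (suc q) ≤ i × Move A i k) ⊎ ((i ≡ suc q × Move A q k) ⊎ (i ≡ suc q × k ≡ suc (suc q) × Move A (suc q) k))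
  B-moves i k mv@(h1 , h2 , c , stair) with trichotomy i (suc q)
  ... | inj₁ lt = ⊥-elim (B-no-move-on-plateau i k h1 (≤-pred lt) mv)
  ... | inj₂ (inj₂ gt) = inj₁ (gt , move-cong (λ j a b → B≡A-beyond j (≤-trans gt a)) mv)
  ... | inj₂ (inj₁ refl) with m≤n⇒m<n∨m≡n h2
  ...   | inj₂ refl with m≤n⇒m<n∨m≡n (≤-pred (≤-trans c (≤-reflexive B-end)))
  ...     | inj₁ lt = inj₂ (inj₂ (refl , refl , cliff⇒move (s≤s z≤n)
                        (≤-trans (≤-reflexive (cong (λ z → suc (suc z)) (sym (B≡A-beyond (suc (suc q)) ≤-refl)))) (≤-trans lt (≤-reflexive (sym A-after))))))
  ...     | inj₂ e = inj₂ (inj₁ (refl , A-move-from-q (suc (suc q)) ≤-refl between-adjacent (trans (cong suc (sym (B≡A-beyond (suc (suc q)) ≤-refl))) e)))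
  B-moves i k mv@(h1 , h2 , c , stair) | inj₂ (inj₁ refl) | inj₁ sq<k' = inj₂ (inj₁ (refl , A-move-from-q k h2 flat ak))
    where
    flat : ∀ j → suc q < j → j < k → A j ≡ v
    flat j a b = trans (sym (B≡A-beyond j a)) (suc-injective (trans (proj₁ (stair j a b)) B-end))
    ak : suc (A k) ≡ v
    ak = trans (cong suc (sym (B≡A-beyond k (<-trans ≤-refl sq<k'))))
               (trans (proj₂ (stair (suc (suc q)) ≤-refl sq<k')) (trans (B≡A-beyond (suc (suc q)) ≤-refl) (flat (suc (suc q)) ≤-refl sq<k')))

  A-moves : ∀ i k → Move A i k
          → (suc (suc q) ≤ i × Move B i k) ⊎ ((i ≡ q × suc (A k) ≡ v × Move B (suc q) k)
            ⊎ ((i ≡ suc q × k ≡ suc (suc q) × suc (suc (A (suc (suc q)))) ≤ v) ⊎ (i ≡ suc q × suc (A (suc (suc q))) ≡ v × Move A (suc q) k)))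
  A-moves i k mv@(h1 , h2 , c , stair) with trichotomy i q
  ... | inj₁ lt = ⊥-elim (A-no-move-on-plateau i k h1 lt mv)
  ... | inj₂ (inj₁ refl) = inj₂ (inj₁ (refl , ak , B-move-from-end k sq<k flat ak))
    where
    sq<k : suc q < k
    sq<k with m≤n⇒m<n∨m≡n h2
    ... | inj₁ lt = lt
    ... | inj₂ refl = ⊥-elim (<-irrefl refl (≤-trans (≤-reflexive (cong (λ z → suc (suc z)) (sym A-after))) (≤-trans c (≤-reflexive A-q))))
    ak : suc (A k) ≡ v
    ak = trans (proj₂ (stair (suc q) ≤-refl sq<k)) A-after
    flat : ∀ j → suc q < j → j < k → A j ≡ v
    flat j a b = suc-injective (trans (proj₁ (stair j (<-trans ≤-refl a) b)) A-q)
  ... | inj₂ (inj₂ gt) with m≤n⇒m<n∨m≡n gt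
  ...   | inj₁ ge = inj₁ (ge , move-cong (λ j a b → sym (B≡A-beyond j (≤-trans ge a))) mv)
  ...   | inj₂ refl with m≤n⇒m<n∨m≡n h2
  ...     | inj₂ refl = inj₂ (inj₂ (inj₁ (refl , refl , ≤-trans c (≤-reflexive A-after))))
  ...     | inj₁ lt = inj₂ (inj₂ (inj₂ (refl , trans (proj₁ (stair (suc (suc q)) ≤-refl lt)) A-after , mv)))

  bump-from-q : ∀ {k₀} → Move A q k₀ → OnlyMove A q k₀ → UniqueMove B
  bump-from-q {k₀} (_ , h2 , c , stair) only = suc q , k₀ , B-move-from-end k₀ sq<k₀ flat ak , only′
    where
    sq<k₀ : suc q < k₀
    sq<k₀ with m≤n⇒m<n∨m≡n h2
    ... | inj₁ lt = lt
    ... | inj₂ refl = ⊥-elim (<-irrefl refl (≤-trans (≤-reflexive (cong (λ z → suc (suc z)) (sym A-after))) (≤-trans c (≤-reflexive A-q))))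
    ak : suc (A k₀) ≡ v
    ak = trans (proj₂ (stair (suc q) ≤-refl sq<k₀)) A-after
    flat : ∀ j → suc q < j → j < k₀ → A j ≡ v
    flat j a b = suc-injective (trans (proj₁ (stair j (<-trans ≤-refl a) b)) A-q)
    only′ : OnlyMove B (suc q) k₀
    only′ i k mv with B-moves i k mv
    ... | inj₁ (ge , mA) = ⊥-elim (<-irrefl (sym (proj₁ (only i k mA))) (≤-trans (n≤1+n _) ge))
    ... | inj₂ (inj₁ (e , mA)) = e , proj₂ (only q k mA)
    ... | inj₂ (inj₂ (_ , _ , mA)) = ⊥-elim (<-irrefl (sym (proj₁ (only (suc q) _ mA))) ≤-refl)

  bump-beyond : ∀ {i₀ k₀} → suc q < i₀ → Move A i₀ k₀ → OnlyMove A i₀ k₀ → UniqueMove B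
  bump-beyond {i₀} {k₀} sq<i₀ mv only = i₀ , k₀ , move-cong (λ j a b → sym (B≡A-beyond j (≤-trans sq<i₀ a))) mv , only′
    where
    only′ : OnlyMove B i₀ k₀
    only′ i k mv′ with B-moves i k mv′
    ... | inj₁ (_ , mA) = only i k mA
    ... | inj₂ (inj₁ (_ , mA)) = ⊥-elim (<-irrefl (proj₁ (only q k mA)) (<-trans ≤-refl sq<i₀))
    ... | inj₂ (inj₂ (_ , _ , mA)) = ⊥-elim (<-irrefl (proj₁ (only (suc q) _ mA)) sq<i₀)

  bump-from-end : ∀ {k₀} → Move A (suc q) k₀ → OnlyMove A (suc q) k₀ → UniqueMove B
  bump-from-end {k₀} (_ , h2 , c , stair) only = suc q , suc (suc q) , B-short-move (≤-trans cA (n≤1+n v)) , only′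
    where
    k₀≡ : k₀ ≡ suc (suc q)
    k₀≡ with m≤n⇒m<n∨m≡n h2
    ... | inj₂ e = sym e
    ... | inj₁ lt = ⊥-elim (<-irrefl (proj₁ (only q (suc (suc q))
                      (A-move-from-q (suc (suc q)) ≤-refl between-adjacent (trans (proj₁ (stair (suc (suc q)) ≤-refl lt)) A-after)))) ≤-refl)
    cA : suc (suc (A (suc (suc q)))) ≤ v
    cA = subst (λ z → suc (suc (A z)) ≤ v) k₀≡ (≤-trans c (≤-reflexive A-after))
    only′ : OnlyMove B (suc q) (suc (suc q))
    only′ i k mv with B-moves i k mv
    ... | inj₁ (ge , mA) = ⊥-elim (<-irrefl (sym (proj₁ (only i k mA))) ge)
    ... | inj₂ (inj₁ (_ , mA)) = ⊥-elim (<-irrefl (proj₁ (only q k mA)) ≤-refl)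
    ... | inj₂ (inj₂ (e , e′ , _)) = e , e′

  bump-unique : UniqueMove A → UniqueMove B
  bump-unique (i₀ , k₀ , mv , only) with trichotomy i₀ q
  ... | inj₁ lt = ⊥-elim (A-no-move-on-plateau i₀ k₀ (proj₁ mv) lt mv)
  ... | inj₂ (inj₁ refl) = bump-from-q mv only
  ... | inj₂ (inj₂ q<i₀) with m≤n⇒m<n∨m≡n q<i₀
  ...   | inj₁ sq<i₀ = bump-beyond sq<i₀ mv only
  ...   | inj₂ refl = bump-from-end mv only

  unbump-beyond : ∀ {i₀ k₀} → suc q < i₀ → Move B i₀ k₀ → OnlyMove B i₀ k₀ → UniqueMove A
  unbump-beyond {i₀} {k₀} sq<i₀ mv only = i₀ , k₀ , move-cong (λ j a b → B≡A-beyond j (≤-trans sq<i₀ a)) mv , only′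
    where
    only′ : OnlyMove A i₀ k₀
    only′ i k mv′ with A-moves i k mv′
    ... | inj₁ (_ , mB) = only i k mB
    ... | inj₂ (inj₁ (_ , _ , mB)) = ⊥-elim (<-irrefl (proj₁ (only _ k mB)) sq<i₀)
    ... | inj₂ (inj₂ (inj₁ (_ , _ , cc))) = ⊥-elim (<-irrefl (proj₁ (only _ _ (B-short-move (≤-trans cc (n≤1+n v))))) sq<i₀)
    ... | inj₂ (inj₂ (inj₂ (_ , ak , _))) = ⊥-elim (<-irrefl (proj₁ (only _ _ (B-short-move (≤-reflexive (cong suc ak))))) sq<i₀)

  unbump-long : ∀ {k₀} → suc (suc q) < k₀ → Move B (suc q) k₀ → OnlyMove B (suc q) k₀ → UniqueMove A
  unbump-long {k₀} sq<k₀ (_ , _ , _ , stair) only = q , k₀ , A-move-from-q k₀ (<-trans ≤-refl sq<k₀) flat ak , only′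
    where
    flat : ∀ j → suc q < j → j < k₀ → A j ≡ v
    flat j a b = trans (sym (B≡A-beyond j a)) (suc-injective (trans (proj₁ (stair j a b)) B-end))
    ak : suc (A k₀) ≡ v
    ak = trans (cong suc (sym (B≡A-beyond k₀ (<-trans ≤-refl sq<k₀))))
               (trans (proj₂ (stair (suc (suc q)) ≤-refl sq<k₀)) (trans (B≡A-beyond (suc (suc q)) ≤-refl) (flat (suc (suc q)) ≤-refl sq<k₀)))
    only′ : OnlyMove A q k₀
    only′ i k mv with A-moves i k mv
    ... | inj₁ (ge , mB) = ⊥-elim (<-irrefl (sym (proj₁ (only i k mB))) ge)
    ... | inj₂ (inj₁ (e , _ , mB)) = e , proj₂ (only _ k mB)
    ... | inj₂ (inj₂ (inj₁ (_ , _ , cc))) = ⊥-elim (<-irrefl refl (≤-trans (n≤1+n _) (≤-trans cc (≤-reflexive (sym (flat (suc (suc q)) ≤-refl sq<k₀))))))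
    ... | inj₂ (inj₂ (inj₂ (_ , ak′ , _))) = ⊥-elim (<-irrefl refl (≤-reflexive (trans ak′ (sym (flat (suc (suc q)) ≤-refl sq<k₀)))))

  -- A keeps the cliff at q+1 unless A_{q+2} = v - 1; then B_{q+2} ≥ 2 would give B a second move beyond q+2,
  -- B_{q+2} = 0 leaves A the single move (q, q+2), and B_{q+2} = 1 is the family E₂.
  unbump-short : NonIncreasingFn B → ∀ K → suc (suc q) < K → B K ≡ 0
               → Move B (suc q) (suc (suc q)) → OnlyMove B (suc q) (suc (suc q)) → UniqueMove A ⊎ ((v ≡ 2) × B (suc (suc q)) ≡ 1)
  unbump-short niB K lK bK (_ , _ , c , _) only with m≤n⇒m<n∨m≡n (≤-pred (≤-trans c (≤-reflexive B-end)))
  ... | inj₁ cliff = inj₁ (suc q , suc (suc q) , cliff⇒move (s≤s z≤n) (≤-trans cA (≤-reflexive (sym A-after))) , only′)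
    where
    cA : suc (suc (A (suc (suc q)))) ≤ v
    cA = ≤-trans (≤-reflexive (cong (λ z → suc (suc z)) (sym (B≡A-beyond _ ≤-refl)))) cliff
    only′ : OnlyMove A (suc q) (suc (suc q))
    only′ i k mv with A-moves i k mv
    ... | inj₁ (ge , mB) = ⊥-elim (<-irrefl (sym (proj₁ (only i k mB))) ge)
    ... | inj₂ (inj₁ (_ , ak , mB)) = ⊥-elim (<-irrefl refl (≤-trans cA (≤-reflexive (sym (subst (λ z → suc (A z) ≡ v) (proj₂ (only _ _ mB)) ak)))))
    ... | inj₂ (inj₂ (inj₁ (e , e′ , _))) = e , e′
    ... | inj₂ (inj₂ (inj₂ (_ , ak , _))) = ⊥-elim (<-irrefl refl (≤-trans cA (≤-reflexive (sym ak))))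
  ... | inj₂ e with ≡0∨≡1∨≥2 (B (suc (suc q)))
  ...   | inj₂ (inj₂ ge2) with move-after niB {suc (suc q)} (s≤s z≤n) lK bK ge2
  ...     | i′ , k′ , le , mB = ⊥-elim (<-irrefl (sym (proj₁ (only i′ k′ mB))) le)
  unbump-short niB K lK bK (_ , _ , c , _) only | inj₂ e | inj₁ zero′ = inj₁ (q , suc (suc q) , A-move-from-q (suc (suc q)) ≤-refl between-adjacent (trans (cong suc Aq+2≡0) (sym v≡1)) , only′)
    where
    Aq+2≡0 : A (suc (suc q)) ≡ 0
    Aq+2≡0 = trans (sym (B≡A-beyond _ ≤-refl)) zero′
    v≡1 : v ≡ 1
    v≡1 = trans (sym e) (cong suc zero′)
    only′ : OnlyMove A q (suc (suc q))
    only′ i k mv with A-moves i k mv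
    ... | inj₁ (ge , mB) = ⊥-elim (<-irrefl (sym (proj₁ (only i k mB))) ge)
    ... | inj₂ (inj₁ (e′ , _ , mB)) = e′ , proj₂ (only _ k mB)
    ... | inj₂ (inj₂ (inj₁ (_ , _ , cc))) = ⊥-elim (<-irrefl refl (≤-trans (s≤s (s≤s z≤n)) (≤-trans cc (≤-reflexive v≡1))))
    ... | inj₂ (inj₂ (inj₂ (_ , _ , (_ , _ , cc , _)))) = ⊥-elim (<-irrefl refl (≤-trans (s≤s (s≤s z≤n)) (≤-trans cc (≤-reflexive (trans A-after v≡1)))))
  unbump-short niB K lK bK (_ , _ , c , _) only | inj₂ e | inj₂ (inj₁ one) = inj₂ (trans (sym e) (cong suc one) , one)

  unbump : NonIncreasingFn B → ∀ K → suc (suc q) < K → B K ≡ 0 → UniqueMove B → UniqueMove A ⊎ ((v ≡ 2) × B (suc (suc q)) ≡ 1)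
  unbump niB K lK bK (i₀ , k₀ , mv , only) with trichotomy i₀ (suc q)
  ... | inj₁ lt = ⊥-elim (B-no-move-on-plateau i₀ k₀ (proj₁ mv) (≤-pred lt) mv)
  ... | inj₂ (inj₂ sq<i₀) = inj₁ (unbump-beyond sq<i₀ mv only)
  ... | inj₂ (inj₁ refl) with m≤n⇒m<n∨m≡n (proj₁ (proj₂ mv))
  ...   | inj₁ long = inj₁ (unbump-long long mv only)
  ...   | inj₂ refl = unbump-short niB K lK bK mv only

unbump-cliff : ∀ {A B} → UniqueMove B → suc (suc (suc (B 2))) ≤ B 1 → Bump 1 A B → UniqueMove A
unbump-cliff {A} {B} (i0 , k0 , mv0 , un0) c bp@(bo , b1) = 1 , 2 , mvA , un
  where
  B2 : B 2 ≡ A 2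
  B2 = bo 2 (λ ())
  cA : suc (suc (A 2)) ≤ A 1
  cA = ≤-pred (≤-trans (≤-reflexive (cong (λ z → suc (suc (suc z))) (sym B2))) (≤-trans c (≤-reflexive b1)))
  mvA : Move A 1 2
  mvA = cliff⇒move (s≤s z≤n) cA
  mvB : Move B 1 2
  mvB = cliff⇒move (s≤s z≤n) (≤-trans (n≤1+n _) c)
  un : ∀ i k → Move A i k → (i ≡ 1) × (k ≡ 2)
  un i k mv@(h1 , h2 , cc , bt) with 1≤⇒≡1∨≥2 h1
  ... | inj₂ 2≤i = ⊥-elim (<-irrefl (sym (trans (proj₁ (un0 i k (move-cong (bump-agrees-after′ bp 2≤i) mv))) (sym (proj₁ (un0 1 2 mvB))))) 2≤i)
  ... | inj₁ refl with m≤n⇒m<n∨m≡n h2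
  ...   | inj₂ e = refl , sym e
  ...   | inj₁ 2<k = ⊥-elim (<-irrefl refl (≤-trans cA (≤-reflexive (sym (proj₁ (bt 2 ≤-refl 2<k))))))

tall-top⇒low-tail : ∀ {B} → NonIncreasingFn B → UniqueMove B → B 1 ≡ suc (suc (B 2)) → ∀ K → 2 < K → B K ≡ 0 → ∀ j → 2 ≤ j → B j ≤ 1
tall-top⇒low-tail {B} ni (i0 , k0 , mv0 , un0) b1 K lK bK j 2≤j with ≡0∨≡1∨≥2 (B 2)
... | inj₂ (inj₂ ge) = ⊥-elim (sr (move-after ni {2} (s≤s z≤n) lK bK ge))
  where
  mvB : Move B 1 2
  mvB = cliff⇒move (s≤s z≤n) (≤-reflexive (sym b1))
  sr : (Σ ℕ λ i' → Σ ℕ λ k' → 2 ≤ i' × Move B i' k') → ⊥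
  sr (i' , k' , le , mB) = <-irrefl (sym (trans (proj₁ (un0 i' k' mB)) (sym (proj₁ (un0 1 2 mvB))))) le
... | inj₁ e = ≤-trans (antitone ni (s≤s z≤n) 2≤j) (≤-trans (≤-reflexive e) z≤n)
... | inj₂ (inj₁ e) = ≤-trans (antitone ni (s≤s z≤n) 2≤j) (≤-reflexive e)

CliffAfterTopPlateau : (ℕ → ℕ) → Set
CliffAfterTopPlateau A = Σ ℕ λ q → 2 ≤ q × (∀ j → 1 ≤ j → j ≤ q → A j ≡ A 1) × suc (suc (A (suc q))) ≤ A q × UniqueMove A

step-move-from-top : ∀ {B} → NonIncreasingFn B → ∀ {k₀} → Move B 1 k₀ → OnlyMove B 1 k₀ → B 1 ≡ suc (B 2)
                   → ∀ K → 2 < K → B K ≡ 0 → B 1 ≡ 2 × B 2 ≡ 1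
step-move-from-top {B} ni {k₀} (_ , 1<k₀ , c , stair) only b1 K 2<K bK with ≡0∨≡1∨≥2 (B 2) | m≤n⇒m<n∨m≡n 1<k₀
... | _ | inj₂ refl = ⊥-elim (<-irrefl refl (≤-trans c (≤-reflexive b1)))
... | inj₁ e | inj₁ 2<k₀ = ⊥-elim (1+n≢0 (trans (proj₂ (stair 2 ≤-refl 2<k₀)) e))
... | inj₂ (inj₁ e) | _ = trans b1 (cong suc e) , e
... | inj₂ (inj₂ ge) | _ with move-after ni {2} (s≤s z≤n) 2<K bK ge
...   | i' , k' , 2≤i' , mv' = ⊥-elim (<-irrefl (sym (proj₁ (only i' k' mv'))) 2≤i')

-- The plateau of B starting at row 2 ends at some q; ending in a step would give B the second move (1, q+1).
step-move-below-top : ∀ {A B} → NonIncreasingFn B → ∀ {i₀ k₀} → 2 ≤ i₀ → Move B i₀ k₀ → OnlyMove B i₀ k₀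
                    → B 1 ≡ suc (B 2) → Bump 1 A B → CliffAfterTopPlateau A
step-move-below-top {A} {B} ni {i₀} {k₀} 2≤i₀ mv only b1 (bo , bA1)
  with Least.least (λ j → 2 ≤ j × B (suc j) < B j) (λ j → (2 ≤? j) ×-dec (B (suc j) <? B j)) i₀ (2≤i₀ , move⇒drop mv)
... | q , (2≤q , dq) , _ , before = q , 2≤q , plA , cliffA , q , suc q , cliff⇒move 1≤q cliffA , only′
  where
  1≤q : 1 ≤ q
  1≤q = ≤-trans (s≤s z≤n) 2≤q
  plB : ∀ j → 2 ≤ j → j ≤ q → B j ≡ B 2
  plB = constant-from (λ t a b → ≤-antisym (ni t (≤-trans (s≤s z≤n) a)) (≮⇒≥ (λ lt → before t b (a , lt))))
  A≡B : ∀ j → 2 ≤ j → A j ≡ B j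
  A≡B j h = sym (bo j (λ e → <-irrefl (sym e) h))
  plA : ∀ j → 1 ≤ j → j ≤ q → A j ≡ A 1
  plA j h le with 1≤⇒≡1∨≥2 h
  ... | inj₁ refl = refl
  ... | inj₂ 2≤j = trans (A≡B j 2≤j) (trans (plB j 2≤j le) (suc-injective (trans (sym b1) bA1)))
  cliffB : suc (suc (B (suc q))) ≤ B q
  cliffB with drop-cases (B q) (B (suc q)) (ni q 1≤q)
  ... | inj₁ c = c
  ... | inj₂ (inj₂ e) = ⊥-elim (<-irrefl e dq)
  ... | inj₂ (inj₁ e) = ⊥-elim (<-irrefl (proj₁ (only 1 (suc q) mB1)) 2≤i₀)
    where
    mB1 : Move B 1 (suc q)
    mB1 = s≤s z≤n , s≤s 1≤q , ≤-reflexive (trans (cong suc (trans e (plB q 2≤q ≤-refl))) (sym b1)) ,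
          λ j a b → trans (cong suc (plB j a (≤-pred b))) (sym b1) , trans e (trans (plB q 2≤q ≤-refl) (sym (plB j a (≤-pred b))))
  cliffA : suc (suc (A (suc q))) ≤ A q
  cliffA = subst₂ (λ x y → suc (suc x) ≤ y) (sym (A≡B (suc q) (≤-trans 2≤q (n≤1+n q)))) (sym (A≡B q 2≤q)) cliffB
  only′ : OnlyMove A q (suc q)
  only′ i k mv′ with 1≤⇒≡1∨≥2 (proj₁ mv′)
  ... | inj₁ refl = ⊥-elim (no-move-at-flat (plA 2 (s≤s z≤n) 2≤q) mv′)
  ... | inj₂ 2≤i = let e = only i k (move-cong (λ j a b → A≡B j (≤-trans 2≤i a)) mv′)
                       e′ = only q (suc q) (cliff⇒move 1≤q cliffB)
                   in trans (proj₁ e) (sym (proj₁ e′)) , trans (proj₂ e) (sym (proj₂ e′))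

unbump-step : ∀ {A B} → NonIncreasingFn B → UniqueMove B → B 1 ≡ suc (B 2) → ∀ K → 2 < K → B K ≡ 0 → Bump 1 A B
            → (B 1 ≡ 2 × B 2 ≡ 1) ⊎ CliffAfterTopPlateau A
unbump-step ni (i₀ , k₀ , mv , only) b1 K 2<K bK bump with 1≤⇒≡1∨≥2 (proj₁ mv)
... | inj₁ refl = inj₁ (step-move-from-top ni mv only b1 K 2<K bK)
... | inj₂ 2≤i₀ = inj₂ (step-move-below-top ni 2≤i₀ mv only b1 bump)

-- Rows of constant height and the families E₁, E₂

psum-block : ∀ {N} (x : Vec ℕ N) s c d → (∀ j → s < j → j ≤ s + d → get x j ≡ c) → psum x (s + d) ≡ psum x s + d * c
psum-block x s c zero h rewrite +-identityʳ s = sym (+-identityʳ _)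
psum-block x s c (suc d) h =
  trans (cong (psum x) (+-suc s d))
  (trans (cong₂ _+_ (psum-block x s c d (λ j a b → h j a (≤-trans b (≤-trans (n≤1+n _) (≤-reflexive (sym (+-suc s d))))))) (h (suc (s + d)) (s≤s (m≤m+n s d)) (≤-reflexive (sym (+-suc s d)))))
        (trans (+-assoc (psum x s) (d * c) c) (cong (psum x s +_) (+-comm (d * c) c))))

Blocks : ∀ {N} → Vec ℕ N → ℕ → ℕ → ℕ → Set
Blocks x m c l = (∀ j → 1 ≤ j → j ≤ m → get x j ≡ c) × (∀ j → m < j → j ≤ m + l → get x j ≡ 1) × (∀ j → m + l < j → get x j ≡ 0)

blocks-sum : ∀ {N} (x : Vec ℕ N) {m c l} → Blocks x m c l → sum x ≡ m * c + l
blocks-sum {N} x {m} {c} {l} (block , ones , zeros) = begin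
  sum x                    ≡⟨ sym (psum-sum x (m + l + N) (m≤n+m N (m + l))) ⟩
  psum x (m + l + N)       ≡⟨ psum-block x (m + l) 0 N (λ j a _ → zeros j a) ⟩
  psum x (m + l) + N * 0   ≡⟨ cong (psum x (m + l) +_) (*-zeroʳ N) ⟩
  psum x (m + l) + 0       ≡⟨ +-identityʳ _ ⟩
  psum x (m + l)           ≡⟨ psum-block x m 1 l ones ⟩
  psum x m + l * 1         ≡⟨ cong₂ _+_ (psum-block x 0 c m block) (*-identityʳ l) ⟩
  m * c + l                ∎
  where open ≡-Reasoning

blocks-tail≤1 : ∀ {N} (x : Vec ℕ N) {m c l} → Blocks x m c l → ∀ j → m < j → get x j ≤ 1
blocks-tail≤1 x {m} {l = l} (_ , ones , zeros) j m<j with j ≤? m + l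
... | yes le = ≤-reflexive (ones j m<j le)
... | no nle = ≤-trans (≤-reflexive (zeros j (≰⇒> nle))) z≤n

blocks-nonIncreasing : ∀ {N} (x : Vec ℕ N) {m c l} → 1 ≤ c → Blocks x m c l → NonIncreasing x
blocks-nonIncreasing x {m} {c} {l} 1≤c bl@(block , ones , zeros) j 1≤j with suc j ≤? m | j ≤? m + l
... | yes sj≤m | _ = ≤-reflexive (trans (block (suc j) (s≤s z≤n) sj≤m) (sym (block j 1≤j (≤-trans (n≤1+n j) sj≤m))))
... | no _ | no j≰m+l = ≤-trans (≤-reflexive (zeros (suc j) (≤-trans (≰⇒> j≰m+l) (n≤1+n _)))) z≤n
... | no sj≰m | yes j≤m+l = ≤-trans (blocks-tail≤1 x bl (suc j) (≰⇒> sj≰m)) 1≤xj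
  where
  1≤xj : 1 ≤ get x j
  1≤xj with j ≤? m
  ... | yes j≤m = ≤-trans 1≤c (≤-reflexive (sym (block j 1≤j j≤m)))
  ... | no j≰m = ≤-reflexive (sym (ones j (≰⇒> j≰m) j≤m+l))

opaque
  tail-of-ones : ∀ {N} (x : Vec ℕ N) → NonIncreasing x → ∀ m c → (∀ j → 1 ≤ j → j ≤ m → get x j ≡ c) → get x (suc m) ≡ 1
               → Σ ℕ λ l → 1 ≤ l × Blocks x m c l
  tail-of-ones {N} x ni m c block xm1 with Least.least (λ j → m < j × get x j ≡ 0) (λ j → (m <? j) ×-dec (get x j ≟ 0)) (suc (N + m)) (s≤s (m≤n+m m N) , get-beyond x _ (s≤s (m≤m+n N m)))
  ... | z , (m<z , xz) , _ , before-z = l , m<n⇒0<n∸m m+1<z , block , ones , zeros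
    where
    m+1<z : suc m < z
    m+1<z with m≤n⇒m<n∨m≡n m<z
    ... | inj₁ lt = lt
    ... | inj₂ refl = ⊥-elim (1+n≢0 (trans (sym xm1) xz))
    l : ℕ
    l = z ∸ suc m
    z≡ : suc (m + l) ≡ z
    z≡ = m+[n∸m]≡n (<⇒≤ m+1<z)
    ones : ∀ j → m < j → j ≤ m + l → get x j ≡ 1
    ones j m<j j≤m+l with ≡0∨≡1∨≥2 (get x j)
    ... | inj₁ e = ⊥-elim (before-z j (≤-trans (s≤s j≤m+l) (≤-reflexive z≡)) (m<j , e))
    ... | inj₂ (inj₁ e) = e
    ... | inj₂ (inj₂ ge) = ⊥-elim (<-irrefl refl (≤-trans ge (≤-trans (antitone ni (s≤s z≤n) m<j) (≤-reflexive xm1))))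
    zeros : ∀ j → m + l < j → get x j ≡ 0
    zeros j lt = n≤0⇒n≡0 (≤-trans (antitone ni (≤-trans (s≤s z≤n) m<z) (≤-trans (≤-reflexive (sym z≡)) lt)) (≤-reflexive xz))

lookup-get : ∀ {m} (v : Vec ℕ m) (i : Fin m) → lookup v i ≡ get v (suc (toℕ i))
lookup-get (x ∷ xs) Fin.zero = refl
lookup-get (x ∷ xs) (Fin.suc i) = lookup-get xs i

module _ (n : ℕ) (β : Vec ℕ (suc n)) where
  get≡lookup : ∀ t (lt : t < suc n) → get β (suc t) ≡ lookup β (fromℕ< lt)
  get≡lookup t lt = sym (trans (lookup-get β (fromℕ< lt)) (cong (λ z → get β (suc z)) (toℕ-fromℕ< lt)))

  E1-blocks : 1 ≤ n → E1 n β → Blocks β 1 2 (pred n)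
  E1-blocks 1≤n h = top , (λ j 2≤j le → mid j 2≤j (≤-trans le (≤-reflexive sp))) , (λ j lt → hi j (≤-trans (s≤s (≤-reflexive (sym sp))) lt))
    where
    sp : suc (pred n) ≡ n
    sp = suc-pred n {{>-nonZero 1≤n}}
    top : ∀ j → 1 ≤ j → j ≤ 1 → get β j ≡ 2
    top (suc zero) _ _ = trans (get≡lookup 0 (s≤s z≤n)) (h (fromℕ< (s≤s z≤n)))
    top (suc (suc j)) _ (s≤s ())
    entry-one : (i : Fin (suc n)) (k : ℕ) → toℕ i ≡ suc k → suc k < n → lookup β i ≡ 1
    entry-one i k eq kn with h i
    ... | e rewrite eq with suc k <? n
    ... | yes _ = e
    ... | no q = ⊥-elim (q kn)
    mid : ∀ j → 2 ≤ j → j ≤ n → get β j ≡ 1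
    mid (suc zero) (s≤s ()) _
    mid (suc (suc k)) _ le = trans (get≡lookup (suc k) (s≤s (<⇒≤ le))) (entry-one (fromℕ< (s≤s (<⇒≤ le))) k (toℕ-fromℕ< (s≤s (<⇒≤ le))) le)
    entry-zero : (i : Fin (suc n)) (k : ℕ) → toℕ i ≡ suc k → ¬ (suc k < n) → lookup β i ≡ 0
    entry-zero i k eq kn with h i
    ... | e rewrite eq with suc k <? n
    ... | yes q = ⊥-elim (kn q)
    ... | no _ = e
    hi : ∀ j → suc n ≤ j → get β j ≡ 0
    hi j le with m≤n⇒m<n∨m≡n le
    ... | inj₁ lt = get-beyond β j lt
    ... | inj₂ refl = trans (get≡lookup n ≤-refl) (entry-zero (fromℕ< ≤-refl) (pred n) (trans (toℕ-fromℕ< (≤-refl {suc n})) (sym sp)) (λ q → <-irrefl sp q))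

  E1-from-rows : (get β 1 ≡ 2) → (∀ j → 2 ≤ j → j ≤ n → get β j ≡ 1) → (∀ j → suc n ≤ j → get β j ≡ 0) → E1 n β
  E1-from-rows v1 mid hi i rewrite lookup-get β i with toℕ i | toℕ<n i
  ... | zero | _ = v1
  ... | suc k | lt with suc k <? n
  ...   | yes p = mid (suc (suc k)) (s≤s (s≤s z≤n)) p
  ...   | no p = hi (suc (suc k)) (s≤s (≮⇒≥ p))

  E2-rows : E2 n β → Σ ℕ λ m → Σ ℕ λ l → 1 ≤ m × 1 ≤ l × 3 * m + l ≡ suc n × Blocks β m 3 l
  E2-rows (m , l , 1≤m , 1≤l , eq , h) = m , l , 1≤m , 1≤l , eq , v3 , v1 , v0
    where
    ml≤ : m + l ≤ suc n
    ml≤ = ≤-trans (+-monoˡ-≤ l (m≤n*m m 3)) (≤-reflexive eq)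
    entry-three : (i : Fin (suc n)) (t : ℕ) → toℕ i ≡ t → t < m → lookup β i ≡ 3
    entry-three i t e tm with h i
    ... | r rewrite e with t <? m
    ... | yes _ = r
    ... | no q = ⊥-elim (q tm)
    v3 : ∀ j → 1 ≤ j → j ≤ m → get β j ≡ 3
    v3 (suc t) _ le = trans (get≡lookup t lt) (entry-three (fromℕ< lt) t (toℕ-fromℕ< lt) le)
      where
      lt : t < suc n
      lt = s≤s (≤-pred (≤-trans le (≤-trans (m≤m+n m l) ml≤)))
    entry-one : (i : Fin (suc n)) (t : ℕ) → toℕ i ≡ t → ¬ (t < m) → t < m + l → lookup β i ≡ 1
    entry-one i t e tm tml with h i
    ... | r rewrite e with t <? m | t <? m + l
    ... | yes q | _ = ⊥-elim (tm q)
    ... | no _ | yes _ = r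
    ... | no _ | no q = ⊥-elim (q tml)
    v1 : ∀ j → m < j → j ≤ m + l → get β j ≡ 1
    v1 (suc t) a b = trans (get≡lookup t lt) (entry-one (fromℕ< lt) t (toℕ-fromℕ< lt) (λ q → <⇒≱ q (≤-pred a)) b)
      where
      lt : t < suc n
      lt = s≤s (≤-pred (≤-trans b ml≤))
    entry-zero : (i : Fin (suc n)) (t : ℕ) → toℕ i ≡ t → ¬ (t < m) → ¬ (t < m + l) → lookup β i ≡ 0
    entry-zero i t e tm tml with h i
    ... | r rewrite e with t <? m | t <? m + l
    ... | yes q | _ = ⊥-elim (tm q)
    ... | no _ | yes q = ⊥-elim (tml q)
    ... | no _ | no _ = r
    v0 : ∀ j → m + l < j → get β j ≡ 0
    v0 (suc t) a with suc t ≤? suc n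
    ... | no q = get-beyond β (suc t) (≰⇒> q)
    ... | yes q = trans (get≡lookup t (s≤s (≤-pred q))) (entry-zero (fromℕ< (s≤s (≤-pred q))) t (toℕ-fromℕ< (s≤s (≤-pred q)))
                    (λ r → <⇒≱ (≤-trans r (m≤m+n m l)) (≤-pred a)) (λ r → <⇒≱ r (≤-pred a)))

  E2-from-rows : ∀ m l → 1 ≤ m → 1 ≤ l → 3 * m + l ≡ suc n → (∀ j → 1 ≤ j → j ≤ m → get β j ≡ 3) → (∀ j → m < j → j ≤ m + l → get β j ≡ 1) → (∀ j → m + l < j → get β j ≡ 0) → E2 n β
  E2-from-rows m l 1≤m 1≤l eq v3 v1 v0 .proj₁ = m
  E2-from-rows m l 1≤m 1≤l eq v3 v1 v0 .proj₂ .proj₁ = l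
  E2-from-rows m l 1≤m 1≤l eq v3 v1 v0 .proj₂ .proj₂ .proj₁ = 1≤m
  E2-from-rows m l 1≤m 1≤l eq v3 v1 v0 .proj₂ .proj₂ .proj₂ .proj₁ = 1≤l
  E2-from-rows m l 1≤m 1≤l eq v3 v1 v0 .proj₂ .proj₂ .proj₂ .proj₂ .proj₁ = eq
  E2-from-rows m l 1≤m 1≤l eq v3 v1 v0 .proj₂ .proj₂ .proj₂ .proj₂ .proj₂ i rewrite lookup-get β i with toℕ i
  ... | t with t <? m | t <? m + l
  ... | yes p | _ = v3 (suc t) (s≤s z≤n) p
  ... | no p | yes q = v1 (suc t) (s≤s (≮⇒≥ p)) q
  ... | no p | no q = v0 (suc t) (s≤s (≮⇒≥ q))

uniqueMove-E₁ : ∀ {B} l → B 1 ≡ 2 → (∀ j → 2 ≤ j → j ≤ suc l → B j ≡ 1) → (∀ j → suc (suc l) ≤ j → B j ≡ 0) → UniqueMove B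
uniqueMove-E₁ {B} l b1 mid hi = 1 , suc (suc l) , mvB , un
  where
  mvB : Move B 1 (suc (suc l))
  mvB = s≤s z≤n , s≤s (s≤s z≤n) , ≤-reflexive (trans (cong (λ z → suc (suc z)) (hi (suc (suc l)) ≤-refl)) (sym b1)) ,
        λ j a b → trans (cong suc (mid j a (≤-pred b))) (sym b1) , trans (cong suc (hi (suc (suc l)) ≤-refl)) (sym (mid j a (≤-pred b)))
  small : ∀ j → 2 ≤ j → B j ≤ 1
  small j h with j ≤? suc l
  ... | yes le = ≤-reflexive (mid j h le)
  ... | no nle = ≤-trans (≤-reflexive (hi j (≰⇒> nle))) z≤n
  un : ∀ i k → Move B i k → (i ≡ 1) × (k ≡ suc (suc l))
  un i k mv@(h1 , h2 , c , bt) with 1≤⇒≡1∨≥2 h1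
  ... | inj₂ 2≤i = ⊥-elim (<-irrefl refl (≤-trans (s≤s (s≤s z≤n)) (≤-trans c (small i 2≤i))))
  ... | inj₁ refl = refl , kk
    where
    bk0 : B k ≡ 0
    bk0 = n≤0⇒n≡0 (≤-pred (≤-pred (≤-trans c (≤-reflexive b1))))
    kk : k ≡ suc (suc l)
    kk with trichotomy k (suc (suc l))
    ... | inj₂ (inj₁ e) = e
    ... | inj₁ lt = ⊥-elim (1+n≢0 (trans (sym (mid k h2 (≤-pred lt))) bk0))
    ... | inj₂ (inj₂ gt) with trans (cong suc (sym (hi (suc (suc l)) ≤-refl))) (trans (proj₁ (bt (suc (suc l)) (s≤s (s≤s z≤n)) gt)) b1)
    ...   | ()

uniqueMove-E₂ : ∀ {B} m → 1 ≤ m → (∀ j → 1 ≤ j → j ≤ m → B j ≡ 3) → (∀ j → m < j → B j ≤ 1) → UniqueMove B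
uniqueMove-E₂ {B} m 1≤m pl lo = m , suc m , mvB , un
  where
  mvB : Move B m (suc m)
  mvB = cliff⇒move (1≤m) (≤-trans (s≤s (s≤s (lo (suc m) ≤-refl))) (≤-reflexive (sym (pl m 1≤m ≤-refl))))
  un : ∀ i k → Move B i k → (i ≡ m) × (k ≡ suc m)
  un i k mv@(h1 , h2 , c , bt) with trichotomy i m
  ... | inj₂ (inj₂ gt) = ⊥-elim (<-irrefl refl (≤-trans (s≤s (s≤s z≤n)) (≤-trans c (lo i gt))))
  ... | inj₁ lt = ⊥-elim (no-move-at-flat (trans (pl (suc i) (s≤s z≤n) lt) (sym (pl i h1 (<⇒≤ lt)))) mv)
  ... | inj₂ (inj₁ refl) with m≤n⇒m<n∨m≡n h2
  ...   | inj₂ e = refl , sym e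
  ...   | inj₁ lt = ⊥-elim (<-irrefl refl (≤-trans (s≤s (s≤s (lo (suc i) ≤-refl))) (≤-reflexive (sym (trans (proj₁ (bt (suc i) ≤-refl lt)) (pl i h1 ≤-refl))))))

¬uniqueMove-3ʳ21ᴸ : ∀ {A} r L → 1 ≤ r → 1 ≤ L → (∀ j → 1 ≤ j → j ≤ r → A j ≡ 3) → A (suc r) ≡ 2 → (∀ j → suc r < j → j ≤ suc r + L → A j ≡ 1) → A (suc (suc r + L)) ≡ 0 → ¬ UniqueMove A
¬uniqueMove-3ʳ21ᴸ {A} r L 1≤r 1≤L a3 a2 a1 a0 (i0 , k0 , _ , un0) = <-irrefl (trans (proj₁ (un0 r _ mv1)) (sym (proj₁ (un0 (suc r) _ mv2)))) ≤-refl
  where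
  A2r : A (suc (suc r)) ≡ 1
  A2r = a1 (suc (suc r)) ≤-refl (s≤s (≤-trans (≤-reflexive (sym (+-comm r 1))) (+-monoʳ-≤ r 1≤L)))
  mv1 : Move A r (suc (suc r))
  mv1 = 1≤r , ≤-trans (n≤1+n _) ≤-refl , ≤-reflexive (trans (cong (λ z → suc (suc z)) A2r) (sym (a3 r 1≤r ≤-refl))) ,
        λ j a b → case≡ j a b
    where
    case≡ : ∀ j → r < j → j < suc (suc r) → (suc (A j) ≡ A r) × (suc (A (suc (suc r))) ≡ A j)
    case≡ j a b with ≤-antisym (≤-pred b) a
    ... | refl = trans (cong suc a2) (sym (a3 r 1≤r ≤-refl)) , trans (cong suc A2r) (sym a2)
  mv2 : Move A (suc r) (suc (suc r + L))
  mv2 = s≤s z≤n , s≤s (s≤s (m≤m+n r L)) , ≤-reflexive (trans (cong (λ z → suc (suc z)) a0) (sym a2)) ,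
        λ j a b → trans (cong suc (a1 j a (≤-pred b))) (sym a2) , trans (cong suc a0) (sym (a1 j a (≤-pred b)))

¬slip×nonSlip : ∀ {n} (x : Vec ℕ n) j → SlipPlateau x j → NonSlipPlateau x j → ⊥
¬slip×nonSlip x j (k1 , j<k1 , z1 , d1) (k2 , j<k2 , z2 , c2) with trichotomy k1 k2
... | inj₁ lt = 1+n≢0 (trans (sym d1) (z2 k1 (<⇒≤ j<k1) lt))
... | inj₂ (inj₁ refl) = <-irrefl refl (≤-trans c2 (≤-reflexive d1))
... | inj₂ (inj₂ gt) = <-irrefl refl (≤-trans (≤-trans (s≤s z≤n) c2) (≤-reflexive (z1 k2 (<⇒≤ j<k2) gt)))

plateau-from-1 : ∀ {n} (α : Vec ℕ n) → NonIncreasing α → ∀ k → (∀ i → 1 ≤ i → i < k → d α i ≡ 0) → ∀ j → 1 ≤ j → j ≤ k → get α j ≡ get α 1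
plateau-from-1 α ni k zs = constant-from (λ t a b → ∸≡0⇒≡ (get α t) (get α (suc t)) (ni t a) (zs t a b))

step-at-1 : ∀ {n} (α : Vec ℕ n) → 1 ≤ get α 1 → NonIncreasing (decAt 1 α) → d (decAt 1 α) 1 ≡ 0 → get α 1 ≡ suc (get α 2)
step-at-1 α h ni z = trans (sym (suc-pred _ {{>-nonZero h}})) (cong suc (trans (sym (get-decAt-same α 1)) (trans (sym e) (get-decAt-other α 1 2 (λ ())))))
  where
  e : get (decAt 1 α) 2 ≡ get (decAt 1 α) 1
  e = ∸≡0⇒≡ _ _ (ni 1 ≤-refl) z

plateau⇒d≡0 : ∀ {n} (x : Vec ℕ n) r → (∀ j → 1 ≤ j → j ≤ r → get x j ≡ get x 1) → ∀ i → 1 ≤ i → i < r → d x i ≡ 0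
plateau⇒d≡0 x r flat i 1≤i i<r = ≡⇒∸≡0 (get x i) (get x (suc i)) (trans (flat (suc i) (s≤s z≤n) i<r) (sym (flat i 1≤i (<⇒≤ i<r))))

threes-then-ones⇒E₂ : ∀ {n} (β : Vec ℕ (suc n)) → IsPartition (suc n) β → ∀ m → 1 ≤ m
                    → (∀ j → 1 ≤ j → j ≤ m → get β j ≡ 3) → get β (suc m) ≡ 1 → E2 n β
threes-then-ones⇒E₂ {n} β (ni , sβ) m 1≤m threes one with tail-of-ones β ni m 3 threes one
... | l , 1≤l , bl@(_ , ones , zeros) =
  E2-from-rows n β m l 1≤m 1≤l (trans (cong (_+ l) (*-comm 3 m)) (trans (sym (blocks-sum β bl)) sβ)) threes ones zeros

two-then-ones⇒E₁ : ∀ {n} (β : Vec ℕ (suc n)) → IsPartition (suc n) β → get β 1 ≡ 2 → get β 2 ≡ 1 → E1 n β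
two-then-ones⇒E₁ {n} β (ni , sβ) b1 b2 with tail-of-ones β ni 1 2 (λ { (suc zero) _ _ → b1 ; (suc (suc j)) _ (s≤s ()) }) b2
... | l , _ , bl@(_ , ones , zeros) =
  E1-from-rows n β b1 (λ j 2≤j j≤n → ones j 2≤j (≤-trans j≤n (≤-reflexive (sym l+1≡n)))) (λ j lt → zeros j (≤-trans (s≤s (≤-reflexive l+1≡n)) lt))
  where
  l+1≡n : suc l ≡ n
  l+1≡n = suc-injective (trans (sym (blocks-sum β bl)) sβ)

-- The pieces

module Soundness (n : ℕ) (3≤n : 3 ≤ n) where
  2≤n : 2 ≤ n
  2≤n = ≤-trans (n≤1+n 2) 3≤n

  PlateauEndImage : Vec ℕ (suc n) → ℕ → Set
  PlateauEndImage β q = Σ (Vec ℕ n) λ α → 1 ≤ q × q ≤ n × JoinIrr n α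
                        × (∀ j → 1 ≤ j → j ≤ q → get α j ≡ suc (get α (suc q))) × down (suc q) α ≡ β

  step-image : ∀ β (α : Vec ℕ n) → JoinIrr n α → 1 ≤ get α 1 → NonIncreasing (decAt 1 α) → ∀ k → 1 < k
             → (∀ i → 1 ≤ i → i < k → d (decAt 1 α) i ≡ 0) → down 2 α ≡ β → PlateauEndImage β 1
  step-image β α ji h nid k 1<k zs eq = α , ≤-refl , ≤-trans (s≤s z≤n) 2≤n , ji , top , eq
    where
    top : ∀ j → 1 ≤ j → j ≤ 1 → get α j ≡ suc (get α 2)
    top (suc zero) _ _ = step-at-1 α h nid (zs 1 ≤-refl 1<k)
    top (suc (suc j)) _ (s≤s ())

  ss-image : ∀ β → InPiece n ss β → PlateauEndImage β 1
  ss-image β (α , ji , (_ , (h , (nid , _) , (k , 1<k , zs , _))) , eq) = step-image β α ji h nid k 1<k zs eq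

  ns-image : ∀ β → InPiece n ns β → PlateauEndImage β 1
  ns-image β (α , ji , (_ , (h , (nid , _) , (k , 1<k , zs , _))) , eq) = step-image β α ji h nid k 1<k zs eq

  pp-image : ∀ l β → InPiece n (pp l) β → PlateauEndImage β (suc l)
  pp-image l β (1≤l , l<n , α , ji , ((ni , _) , (_ , (_ , zs , d1))) , eq) =
    α , s≤s z≤n , l<n , ji , pl , trans (cong (λ z → down z α) (+-comm 2 l)) eq
    where
    pl : ∀ j → 1 ≤ j → j ≤ suc l → get α j ≡ suc (get α (suc (suc l)))
    pl j a b = trans (plateau-from-1 α ni (suc l) zs j a b)
                     (trans (sym (plateau-from-1 α ni (suc l) zs (suc l) (s≤s z≤n) ≤-refl)) (sym (∸≡1⇒suc≡ _ _ d1)))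

  image-joinIrr : ∀ β q → PlateauEndImage β q → JoinIrr (suc n) β
  image-joinIrr β q (α , 1≤q , q≤n , ji , pl , refl) = down-joinIrr α (suc q) ji (s≤s z≤n) (s≤s q≤n) plateau-above
    (λ _ um bp → BumpPlateauEnd.bump-unique 1≤q pl refl bp um)
    where
    plateau-above : ∀ j → 1 ≤ j → suc j ≡ suc q → suc (get α (suc q)) ≤ get α j
    plateau-above j h refl = ≤-reflexive (sym (pl j h ≤-refl))

  sound : ∀ p β → InPiece n p β → JoinIrr (suc n) β
  sound cl β (α , ji , (_ , c) , refl) =
    down-joinIrr α 1 ji ≤-refl (s≤s z≤n) (λ { zero () _ ; (suc j) _ () }) (λ _ um bp → bump-cliff um (∸≥2⇒2+≤ _ _ c) bp)
  sound np β (α , ji , (_ , (k , 1<k , zs , c)) , refl) =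
    down-joinIrr α 1 ji ≤-refl (s≤s z≤n) (λ { zero () _ ; (suc j) _ () })
      (λ ni um bp → bump-nonSlipPlateau ni um k 1<k (plateau-from-1 α ni k zs) (∸≥2⇒2+≤ _ _ c) bp)
  sound ss β h = image-joinIrr β 1 (ss-image β h)
  sound ns β h = image-joinIrr β 1 (ns-image β h)
  sound (pp l) β h = image-joinIrr β (suc l) (pp-image l β h)
  sound e1 β h = uniqueMove⇒joinIrr β (blocks-nonIncreasing β (s≤s z≤n) rows , trans (blocks-sum β rows) (cong suc (suc-pred n {{>-nonZero 1≤n}})))
                   (uniqueMove-E₁ (pred n) (proj₁ rows 1 ≤-refl ≤-refl) (proj₁ (proj₂ rows)) (proj₂ (proj₂ rows)))
    where
    1≤n : 1 ≤ n
    1≤n = ≤-trans (s≤s z≤n) 2≤n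
    rows : Blocks β 1 2 (pred n)
    rows = E1-blocks n β 1≤n h
  sound e2 β h with E2-rows n β h
  ... | m , l , 1≤m , 1≤l , eq , rows@(threes , _) =
    uniqueMove⇒joinIrr β (blocks-nonIncreasing β (s≤s z≤n) rows , trans (blocks-sum β rows) (trans (cong (_+ l) (*-comm m 3)) eq))
      (uniqueMove-E₂ m 1≤m threes (blocks-tail≤1 β rows))

  image-top : ∀ β q → PlateauEndImage β q → (∀ j → 1 ≤ j → j ≤ suc q → get β j ≡ get β 1) × get β (suc (suc q)) < get β 1
  image-top β q (α , 1≤q , q≤n , ji , pl , refl) =
    (λ j a b → trans (B-plateau j a b) (sym (B-plateau 1 ≤-refl (s≤s z≤n)))) ,
    ≤-trans (s≤s (≤-trans (≤-reflexive (B≡A-beyond _ ≤-refl)) (proj₁ (proj₁ (joinIrr⇒uniqueMove α ji)) (suc q) (s≤s z≤n))))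
            (≤-reflexive (sym (B-plateau 1 ≤-refl (s≤s z≤n))))
    where open BumpPlateauEnd 1≤q pl refl (down-bump α (suc q) (s≤s z≤n) (s≤s q≤n))

  -- Such a β would come from α = (3ʳ, 2, 1ᴸ, 0, …), which has the two moves (r, r+2) and (r+1, r+L+2).
  ⊥e2-image : ∀ β q → PlateauEndImage β q → InPiece n e2 β → ⊥
  ⊥e2-image β q pd@(α , 1≤q , q≤n , ji , pl , refl) h with E2-rows n β h | image-top β q pd
  ... | m , l , 1≤m , 1≤l , eq , v3 , v1 , v0 | plB , lt = ¬uniqueMove-3ʳ21ᴸ {get α} q l 1≤q 1≤l a3 a2 a1 a0 (proj₂ (joinIrr⇒uniqueMove α ji))
    where
    bp : Bump (suc q) (get α) (get (down (suc q) α))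
    bp = down-bump α (suc q) (s≤s z≤n) (s≤s q≤n)
    B1 : get (down (suc q) α) 1 ≡ 3
    B1 = v3 1 ≤-refl 1≤m
    sq≡m : suc q ≡ m
    sq≡m with trichotomy (suc q) m
    ... | inj₂ (inj₁ e) = e
    ... | inj₁ lt' = ⊥-elim (<-irrefl (trans (v3 (suc (suc q)) (s≤s z≤n) lt') (sym B1)) lt)
    ... | inj₂ (inj₂ gt) with suc q ≤? m + l
    ...   | yes le = contradiction (trans (sym (v1 (suc q) gt le)) (trans (plB (suc q) (s≤s z≤n) ≤-refl) B1)) λ ()
    ...   | no nle = ⊥-elim (1+n≢0 (trans (sym (trans (plB (suc q) (s≤s z≤n) ≤-refl) B1)) (v0 (suc q) (≰⇒> nle))))
    a3 : ∀ j → 1 ≤ j → j ≤ q → get α j ≡ 3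
    a3 j a b = trans (sym (proj₁ bp j (λ e → <-irrefl e (s≤s b)))) (v3 j a (≤-trans (n≤1+n _) (≤-trans (s≤s b) (≤-reflexive sq≡m))))
    a2 : get α (suc q) ≡ 2
    a2 = suc-injective (trans (sym (proj₂ bp)) (v3 (suc q) (s≤s z≤n) (≤-reflexive sq≡m)))
    a1 : ∀ j → suc q < j → j ≤ suc q + l → get α j ≡ 1
    a1 j a b = trans (sym (proj₁ bp j (λ e → <-irrefl (sym e) a))) (v1 j (subst (_< j) sq≡m a) (subst (λ z → j ≤ z + l) sq≡m b))
    a0 : get α (suc (suc q + l)) ≡ 0
    a0 = trans (sym (proj₁ bp _ (λ e → <-irrefl (sym e) (s≤s (m≤m+n (suc q) l))))) (v0 _ (subst (λ z → z + l < suc (suc q + l)) sq≡m ≤-refl))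

  cl-top : ∀ β → InPiece n cl β → suc (suc (suc (get β 2))) ≤ get β 1
  cl-top β (α , ji , (pa , c) , refl) = ≤-trans (s≤s (≤-trans (≤-reflexive (cong (λ z → suc (suc z)) (proj₁ bp 2 (λ ())))) (∸≥2⇒2+≤ _ _ c))) (≤-reflexive (sym (proj₂ bp)))
    where
    bp : Bump 1 (get α) (get (down 1 α))
    bp = down-bump α 1 ≤-refl (s≤s z≤n)

  np-top : ∀ β → InPiece n np β → (get β 1 ≡ suc (get β 2)) × (2 ≤ get β 2)
  np-top β (α , ji , ((ni , _) , (k , 1<k , zs , c)) , refl) =
    trans (proj₂ bp) (cong suc (trans (sym a21) (sym b2))) ,
    ≤-trans (≤-trans (s≤s (s≤s z≤n)) (∸≥2⇒2+≤ (get α k) (get α (suc k)) c)) (≤-reflexive (trans (plateau-from-1 α ni k zs k (≤-trans (s≤s z≤n) 1<k) ≤-refl) (trans (sym a21) (sym b2))))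
    where
    bp : Bump 1 (get α) (get (down 1 α))
    bp = down-bump α 1 ≤-refl (s≤s z≤n)
    b2 : get (down 1 α) 2 ≡ get α 2
    b2 = proj₁ bp 2 (λ ())
    a21 : get α 2 ≡ get α 1
    a21 = plateau-from-1 α ni k zs 2 (s≤s z≤n) 1<k

  e1-top : ∀ β → InPiece n e1 β → (get β 1 ≡ 2) × (get β 2 ≡ 1)
  e1-top β h with E1-blocks n β (≤-trans (s≤s z≤n) 2≤n) h
  ... | top , ones , _ = top 1 ≤-refl ≤-refl , ones 2 ≤-refl (s≤s (pred-mono-≤ 2≤n))

  e2-top : ∀ β → InPiece n e2 β → (get β 1 ≡ 3) × ((get β 2 ≡ 1) ⊎ (get β 2 ≡ 3))
  e2-top β h with E2-rows n β h
  ... | m , l , 1≤m , 1≤l , eq , v3 , v1 , v0 = v3 1 ≤-refl 1≤m , b2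
    where
    b2 : (get β 2 ≡ 1) ⊎ (get β 2 ≡ 3)
    b2 with 1≤⇒≡1∨≥2 1≤m
    ... | inj₁ refl = inj₁ (v1 2 ≤-refl (s≤s 1≤l))
    ... | inj₂ 2≤m = inj₂ (v3 2 (s≤s z≤n) 2≤m)

  image-top-flat : ∀ β q → PlateauEndImage β q → get β 2 ≡ get β 1
  image-top-flat β q pd@(_ , 1≤q , _) = proj₁ (image-top β q pd) 2 (s≤s z≤n) (s≤s 1≤q)

  ⊥cl-pl : ∀ β q → InPiece n cl β → PlateauEndImage β q → ⊥
  ⊥cl-pl β q h pd = <-irrefl refl (≤-trans (n≤1+n (suc (get β 2))) (≤-trans (n≤1+n (suc (suc (get β 2)))) (≤-trans (cl-top β h) (≤-reflexive (sym (image-top-flat β q pd))))))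
  ⊥np-pl : ∀ β q → InPiece n np β → PlateauEndImage β q → ⊥
  ⊥np-pl β q h pd = <-irrefl refl (≤-reflexive (trans (sym (proj₁ (np-top β h))) (sym (image-top-flat β q pd))))
  ⊥e1-pl : ∀ β q → InPiece n e1 β → PlateauEndImage β q → ⊥
  ⊥e1-pl β q h pd with e1-top β h
  ... | a , b = contradiction (trans (sym b) (trans (image-top-flat β q pd) a)) λ ()
  ⊥cl-np : ∀ β → InPiece n cl β → InPiece n np β → ⊥
  ⊥cl-np β h h' = <-irrefl refl (≤-trans (n≤1+n (suc (suc (get β 2)))) (≤-trans (cl-top β h) (≤-reflexive (proj₁ (np-top β h')))))
  ⊥cl-e1 : ∀ β → InPiece n cl β → InPiece n e1 β → ⊥
  ⊥cl-e1 β h h' = n≮0 (≤-pred (≤-pred (≤-trans (cl-top β h) (≤-reflexive (proj₁ (e1-top β h'))))))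
  ⊥cl-e2 : ∀ β → InPiece n cl β → InPiece n e2 β → ⊥
  ⊥cl-e2 β h h' with e2-top β h'
  ... | b1 , inj₁ b2 = n≮0 (≤-pred (≤-pred (≤-pred (≤-trans (≤-reflexive (cong (λ z → suc (suc (suc z))) (sym b2))) (≤-trans (cl-top β h) (≤-reflexive b1))))))
  ... | b1 , inj₂ b2 = n≮0 (≤-pred (≤-pred (≤-pred (≤-trans (≤-reflexive (cong (λ z → suc (suc (suc z))) (sym b2))) (≤-trans (cl-top β h) (≤-reflexive b1))))))
  ⊥np-e1 : ∀ β → InPiece n np β → InPiece n e1 β → ⊥
  ⊥np-e1 β h h' = <-irrefl refl (≤-trans (proj₂ (np-top β h)) (≤-reflexive (proj₂ (e1-top β h'))))
  ⊥np-e2 : ∀ β → InPiece n np β → InPiece n e2 β → ⊥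
  ⊥np-e2 β h h' with e2-top β h' | np-top β h
  ... | b1 , inj₁ b2 | e , _ = contradiction (suc-injective (trans (trans (sym b1) e) (cong suc b2))) λ ()
  ... | b1 , inj₂ b2 | e , _ = contradiction (suc-injective (trans (trans (sym b1) e) (cong suc b2))) λ ()
  ⊥e1-e2 : ∀ β → InPiece n e1 β → InPiece n e2 β → ⊥
  ⊥e1-e2 β h h' = contradiction (trans (sym (proj₁ (e1-top β h))) (proj₁ (e2-top β h'))) λ ()
  ⊥ss-ns : ∀ β → InPiece n ss β → InPiece n ns β → ⊥
  ⊥ss-ns β (α , _ , (_ , (_ , _ , sl)) , eq) (α' , _ , (_ , (_ , _ , nsl)) , eq') with get-ext α α' same
    where
    bp : Bump 2 (get α) (get (down 2 α))
    bp = down-bump α 2 (s≤s z≤n) (s≤s (≤-trans (s≤s z≤n) 2≤n))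
    bp' : Bump 2 (get α') (get (down 2 α'))
    bp' = down-bump α' 2 (s≤s z≤n) (s≤s (≤-trans (s≤s z≤n) 2≤n))
    eqB : ∀ j → get (down 2 α) j ≡ get (down 2 α') j
    eqB j = cong (λ z → get z j) (trans eq (sym eq'))
    same : ∀ j → 1 ≤ j → get α j ≡ get α' j
    same j _ with j ≟ 2
    ... | yes refl = suc-injective (trans (sym (proj₂ bp)) (trans (eqB 2) (proj₂ bp')))
    ... | no ne = trans (sym (proj₁ bp j ne)) (trans (eqB j) (proj₁ bp' j ne))
  ... | refl = ¬slip×nonSlip (decAt 1 α) 1 sl nsl
  ⊥pl-pp : ∀ β l → InPiece n (pp l) β → PlateauEndImage β 1 → ⊥
  ⊥pl-pp β l h pd with h
  ... | 1≤l , _ = <-irrefl (proj₁ (image-top β (suc l) (pp-image l β h)) 3 (s≤s z≤n) (s≤s (s≤s 1≤l))) (proj₂ (image-top β 1 pd))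
  ⊥pp-pp : ∀ β l l' → InPiece n (pp l) β → InPiece n (pp l') β → l < l' → ⊥
  ⊥pp-pp β l l' h h' lt = <-irrefl (proj₁ (image-top β (suc l') (pp-image l' β h')) (suc (suc (suc l))) (s≤s z≤n) (s≤s (s≤s lt))) (proj₂ (image-top β (suc l) (pp-image l β h)))

  -- Pieces are told apart by the top of β: the length of its top plateau and the size of the drop after it.
  pieces-disjoint : ∀ p q β → InPiece n p β → InPiece n q β → p ≡ q
  pieces-disjoint cl cl β h h' = refl
  pieces-disjoint cl np β h h' = ⊥-elim (⊥cl-np β h h')
  pieces-disjoint cl ss β h h' = ⊥-elim (⊥cl-pl β 1 h (ss-image β h'))
  pieces-disjoint cl ns β h h' = ⊥-elim (⊥cl-pl β 1 h (ns-image β h'))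
  pieces-disjoint cl (pp l) β h h' = ⊥-elim (⊥cl-pl β _ h (pp-image l β h'))
  pieces-disjoint cl e1 β h h' = ⊥-elim (⊥cl-e1 β h h')
  pieces-disjoint cl e2 β h h' = ⊥-elim (⊥cl-e2 β h h')
  pieces-disjoint np cl β h h' = ⊥-elim (⊥cl-np β h' h)
  pieces-disjoint np np β h h' = refl
  pieces-disjoint np ss β h h' = ⊥-elim (⊥np-pl β 1 h (ss-image β h'))
  pieces-disjoint np ns β h h' = ⊥-elim (⊥np-pl β 1 h (ns-image β h'))
  pieces-disjoint np (pp l) β h h' = ⊥-elim (⊥np-pl β _ h (pp-image l β h'))
  pieces-disjoint np e1 β h h' = ⊥-elim (⊥np-e1 β h h')
  pieces-disjoint np e2 β h h' = ⊥-elim (⊥np-e2 β h h')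
  pieces-disjoint ss cl β h h' = ⊥-elim (⊥cl-pl β 1 h' (ss-image β h))
  pieces-disjoint ss np β h h' = ⊥-elim (⊥np-pl β 1 h' (ss-image β h))
  pieces-disjoint ss ss β h h' = refl
  pieces-disjoint ss ns β h h' = ⊥-elim (⊥ss-ns β h h')
  pieces-disjoint ss (pp l) β h h' = ⊥-elim (⊥pl-pp β l h' (ss-image β h))
  pieces-disjoint ss e1 β h h' = ⊥-elim (⊥e1-pl β 1 h' (ss-image β h))
  pieces-disjoint ss e2 β h h' = ⊥-elim (⊥e2-image β 1 (ss-image β h) h')
  pieces-disjoint ns cl β h h' = ⊥-elim (⊥cl-pl β 1 h' (ns-image β h))
  pieces-disjoint ns np β h h' = ⊥-elim (⊥np-pl β 1 h' (ns-image β h))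
  pieces-disjoint ns ss β h h' = ⊥-elim (⊥ss-ns β h' h)
  pieces-disjoint ns ns β h h' = refl
  pieces-disjoint ns (pp l) β h h' = ⊥-elim (⊥pl-pp β l h' (ns-image β h))
  pieces-disjoint ns e1 β h h' = ⊥-elim (⊥e1-pl β 1 h' (ns-image β h))
  pieces-disjoint ns e2 β h h' = ⊥-elim (⊥e2-image β 1 (ns-image β h) h')
  pieces-disjoint (pp l) cl β h h' = ⊥-elim (⊥cl-pl β _ h' (pp-image l β h))
  pieces-disjoint (pp l) np β h h' = ⊥-elim (⊥np-pl β _ h' (pp-image l β h))
  pieces-disjoint (pp l) ss β h h' = ⊥-elim (⊥pl-pp β l h (ss-image β h'))
  pieces-disjoint (pp l) ns β h h' = ⊥-elim (⊥pl-pp β l h (ns-image β h'))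
  pieces-disjoint (pp l) (pp l') β h h' with trichotomy l l'
  ... | inj₂ (inj₁ refl) = refl
  ... | inj₁ lt = ⊥-elim (⊥pp-pp β l l' h h' lt)
  ... | inj₂ (inj₂ gt) = ⊥-elim (⊥pp-pp β l' l h' h gt)
  pieces-disjoint (pp l) e1 β h h' = ⊥-elim (⊥e1-pl β _ h' (pp-image l β h))
  pieces-disjoint (pp l) e2 β h h' = ⊥-elim (⊥e2-image β _ (pp-image l β h) h')
  pieces-disjoint e1 cl β h h' = ⊥-elim (⊥cl-e1 β h' h)
  pieces-disjoint e1 np β h h' = ⊥-elim (⊥np-e1 β h' h)
  pieces-disjoint e1 ss β h h' = ⊥-elim (⊥e1-pl β 1 h (ss-image β h'))
  pieces-disjoint e1 ns β h h' = ⊥-elim (⊥e1-pl β 1 h (ns-image β h'))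
  pieces-disjoint e1 (pp l) β h h' = ⊥-elim (⊥e1-pl β _ h (pp-image l β h'))
  pieces-disjoint e1 e1 β h h' = refl
  pieces-disjoint e1 e2 β h h' = ⊥-elim (⊥e1-e2 β h h')
  pieces-disjoint e2 cl β h h' = ⊥-elim (⊥cl-e2 β h' h)
  pieces-disjoint e2 np β h h' = ⊥-elim (⊥np-e2 β h' h)
  pieces-disjoint e2 ss β h h' = ⊥-elim (⊥e2-image β 1 (ss-image β h') h)
  pieces-disjoint e2 ns β h h' = ⊥-elim (⊥e2-image β 1 (ns-image β h') h)
  pieces-disjoint e2 (pp l) β h h' = ⊥-elim (⊥e2-image β _ (pp-image l β h') h)
  pieces-disjoint e2 e1 β h h' = ⊥-elim (⊥e1-e2 β h' h)
  pieces-disjoint e2 e2 β h h' = refl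

module Pieces (n : ℕ) (3≤n : 3 ≤ n) (β : Vec ℕ (suc n)) where
  pp-piece : ∀ (α : Vec ℕ n) l → 1 ≤ l → l < n → JoinIrr n α
           → (∀ j → 1 ≤ j → j ≤ suc l → get α j ≡ suc (get α (suc (suc l)))) → down (suc (suc l)) α ≡ β → InPiece n (pp l) β
  pp-piece α l 1≤l l<n ji pl eq =
    1≤l , l<n , α , ji , (proj₁ ji , (1≤l , (s≤s 1≤l , plateau⇒d≡0 α (suc l) flat , d1))) , trans (cong (λ z → down z α) (+-comm l 2)) eq
    where
    flat : ∀ j → 1 ≤ j → j ≤ suc l → get α j ≡ get α 1
    flat j a b = trans (pl j a b) (sym (pl 1 ≤-refl (s≤s z≤n)))
    d1 : d α (suc l) ≡ 1
    d1 = suc≡⇒∸≡1 _ _ (sym (pl (suc l) (s≤s z≤n) ≤-refl))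

  module Step (α : Vec ℕ n) (ji : JoinIrr n α) (a1 : get α 1 ≡ suc (get α 2)) where
    α′ : Vec ℕ n
    α′ = decAt 1 α
    pα : IsPartition n α
    pα = proj₁ ji
    1≤α1 : 1 ≤ get α 1
    1≤α1 = ≤-trans (s≤s z≤n) (≤-reflexive (sym a1))
    α′1 : get α′ 1 ≡ get α 2
    α′1 = trans (get-decAt-same α 1) (cong pred a1)
    α′2 : get α′ 2 ≡ get α′ 1
    α′2 = trans (get-decAt-other α 1 2 (λ ())) (sym α′1)
    1≤α′1 : 1 ≤ get α′ 1
    1≤α′1 = ≤-trans (≤-pred (≤-trans (move⇒2≤top (proj₁ pα) (proj₁ (proj₂ (proj₂ um)))) (≤-reflexive a1))) (≤-reflexive (sym α′1))
      where
      um : UniqueMove (get α)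
      um = proj₂ (joinIrr⇒uniqueMove α ji)
    ni′ : NonIncreasing α′
    ni′ (suc zero) _ = ≤-reflexive α′2
    ni′ (suc (suc j)) _ = ≤-trans (≤-reflexive (get-decAt-other α 1 (suc (suc (suc j))) (λ ())))
                          (≤-trans (proj₁ pα (suc (suc j)) (s≤s z≤n)) (≤-reflexive (sym (get-decAt-other α 1 (suc (suc j)) (λ ())))))
    pα′ : IsPartition (pred n) α′
    pα′ = ni′ , trans (sym (psum-sum α′ n ≤-refl))
                      (cong pred (trans (psum-decAt-≥ α 1 n ≤-refl 1≤α1 (≤-trans (s≤s z≤n) 3≤n)) (trans (psum-sum α n ≤-refl) (proj₂ pα))))

    piece-from-drop : ∀ r → 1 ≤ r → get α′ (suc r) < get α′ r → (∀ j → 1 ≤ j → j ≤ r → get α′ j ≡ get α′ 1)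
                    → down 2 α ≡ β → InPiece n ss β ⊎ InPiece n ns β
    piece-from-drop r 1≤r drop flat eq with 1≤⇒≡1∨≥2 1≤r | drop-cases (get α′ r) (get α′ (suc r)) (ni′ r 1≤r)
    ... | inj₁ refl | _ = ⊥-elim (<-irrefl α′2 drop)
    ... | inj₂ 2≤r | inj₁ c = inj₂ (α , ji , (pα , (1≤α1 , pα′ , (r , 2≤r , plateau⇒d≡0 α′ r flat , 2+≤⇒2≤∸ _ _ c))) , eq)
    ... | inj₂ 2≤r | inj₂ (inj₁ e) = inj₁ (α , ji , (pα , (1≤α1 , pα′ , (r , 2≤r , plateau⇒d≡0 α′ r flat , suc≡⇒∸≡1 _ _ e))) , eq)
    ... | inj₂ _ | inj₂ (inj₂ e) = ⊥-elim (<-irrefl e drop)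

    piece : down 2 α ≡ β → InPiece n ss β ⊎ InPiece n ns β
    piece with first-drop α′ ni′ 1≤α′1
    ... | r , 1≤r , drop , flat = piece-from-drop r 1≤r drop flat

  plateau-end-piece : ∀ (α : Vec ℕ n) r → suc r < n → JoinIrr n α
    → (∀ j → 1 ≤ j → j ≤ suc r → get α j ≡ suc (get α (suc (suc r)))) → down (suc (suc r)) α ≡ β → Σ Piece λ pc → InPiece n pc β
  plateau-end-piece α zero _ ji pl eq with Step.piece α ji (pl 1 ≤-refl ≤-refl) eq
  ... | inj₁ h = ss , h
  ... | inj₂ h = ns , h
  plateau-end-piece α (suc r) r<n ji pl eq = pp (suc r) , pp-piece α (suc r) (s≤s z≤n) (<-trans (n<1+n _) r<n) ji pl eq

module Completeness (n : ℕ) (3≤n : 3 ≤ n) (β : Vec ℕ (suc n)) (ji : JoinIrr (suc n) β) where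
  open Pieces n 3≤n β

  B : ℕ → ℕ
  B = get β

  opaque
    pB : IsPartition (suc n) β
    pB = proj₁ (joinIrr⇒uniqueMove β ji)

    umB : UniqueMove B
    umB = proj₂ (joinIrr⇒uniqueMove β ji)

  niB : NonIncreasing β
  niB = proj₁ pB

  mvB : Move B (proj₁ umB) (proj₁ (proj₂ umB))
  mvB = proj₁ (proj₂ (proj₂ umB))

  last-empty : B (suc n) ≡ 0
  last-empty = move⇒last-empty β pB mvB

  beyond : B (suc (suc n)) ≡ 0
  beyond = get-beyond β _ ≤-refl

  2<n+2 : 2 < suc (suc n)
  2<n+2 = s≤s (s≤s (≤-trans (s≤s z≤n) 3≤n))

  TopPlateau : ℕ → Set
  TopPlateau p = 1 ≤ p × B (suc p) < B p × (∀ j → 1 ≤ j → j ≤ p → B j ≡ B 1)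

  top-plateau-bound : ∀ {p} → TopPlateau p → p ≤ n
  top-plateau-bound {p} (_ , drop , _) with p ≤? n
  ... | yes p≤n = p≤n
  ... | no p≰n = ⊥-elim (n≮0 (subst (B (suc p) <_) Bp≡0 drop))
    where
    Bp≡0 : B p ≡ 0
    Bp≡0 with m≤n⇒m<n∨m≡n (≰⇒> p≰n)
    ... | inj₁ lt = get-beyond β p lt
    ... | inj₂ refl = last-empty

  module Unbumped {p} (tp : TopPlateau p) where
    unbumped : Σ (Vec ℕ n) λ α → IsPartition n α × Bump p (get α) B × down p α ≡ β
    unbumped = undown β pB (proj₁ tp) (top-plateau-bound tp) (proj₁ (proj₂ tp)) last-empty
    α : Vec ℕ n
    α = proj₁ unbumped
    A : ℕ → ℕ
    A = get α
    pα : IsPartition n α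
    pα = proj₁ (proj₂ unbumped)
    bump : Bump p A B
    bump = proj₁ (proj₂ (proj₂ unbumped))
    down≡β : down p α ≡ β
    down≡β = proj₂ (proj₂ (proj₂ unbumped))

  module TopRow (tp : TopPlateau 1) where
    open Unbumped tp

    cliff-piece : suc (suc (suc (B 2))) ≤ B 1 → InPiece n cl β
    cliff-piece c = α , uniqueMove⇒joinIrr α pα (unbump-cliff umB c bump) , (pα , 2+≤⇒2≤∸ _ _ cA) , down≡β
      where
      cA : suc (suc (A 2)) ≤ A 1
      cA = ≤-pred (≤-trans (≤-reflexive (cong (λ z → suc (suc (suc z))) (sym (proj₁ bump 2 (λ ()))))) (≤-trans c (≤-reflexive (proj₂ bump))))

    -- β = (2, 0, …) would have sum 2 < n + 1.
    tall-step-piece : B 1 ≡ suc (suc (B 2)) → InPiece n e2 β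
    tall-step-piece b1 with ≡0∨≡1∨≥2 (B 2)
    ... | inj₂ (inj₁ b2) = threes-then-ones⇒E₂ β pB 1 ≤-refl (λ { (suc zero) _ _ → trans b1 (cong (λ z → suc (suc z)) b2) ; (suc (suc j)) _ (s≤s ()) }) b2
    ... | inj₂ (inj₂ 2≤B2) = ⊥-elim (<-irrefl refl (≤-trans 2≤B2 (tall-top⇒low-tail niB umB b1 (suc (suc n)) 2<n+2 beyond 2 ≤-refl)))
    ... | inj₁ b2 = contradiction (≤-trans 3≤n (≤-reflexive (suc-injective n+1≡2))) λ { (s≤s ()) }
      where
      n+1≡2 : suc n ≡ 2
      n+1≡2 = begin
        suc n                ≡⟨ sym (proj₂ pB) ⟩
        sum β                ≡⟨ sym (psum-sum β (suc n) ≤-refl) ⟩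
        psum β (1 + n)       ≡⟨ psum-block β 1 0 n (λ j 1<j _ → n≤0⇒n≡0 (≤-trans (antitone niB (s≤s z≤n) 1<j) (≤-reflexive b2))) ⟩
        psum β 1 + n * 0     ≡⟨ cong₂ _+_ (trans b1 (cong (λ z → suc (suc z)) b2)) (*-zeroʳ n) ⟩
        2                    ∎
        where open ≡-Reasoning

    step-piece : B 1 ≡ suc (B 2) → Σ Piece λ pc → InPiece n pc β
    step-piece b1 with unbump-step niB umB b1 (suc (suc n)) 2<n+2 beyond bump
    ... | inj₁ (b1≡2 , b2≡1) = e1 , two-then-ones⇒E₁ β pB b1≡2 b2≡1
    ... | inj₂ (q , 2≤q , plA , cliffA , umA) =
      np , α , uniqueMove⇒joinIrr α pα umA , (pα , (q , 2≤q , plateau⇒d≡0 α q plA , 2+≤⇒2≤∸ _ _ cliffA)) , down≡β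

    piece : Σ Piece λ pc → InPiece n pc β
    piece with drop-cases (B 1) (B 2) (niB 1 ≤-refl)
    ... | inj₂ (inj₂ flat) = ⊥-elim (<-irrefl flat (proj₁ (proj₂ tp)))
    ... | inj₂ (inj₁ step) = step-piece (sym step)
    ... | inj₁ cliff with m≤n⇒m<n∨m≡n cliff
    ...   | inj₁ cliff3 = cl , cliff-piece cliff3
    ...   | inj₂ step2 = e2 , tall-step-piece (sym step2)

  module PlateauEnd (r : ℕ) (tp : TopPlateau (suc (suc r))) where
    open Unbumped tp

    B-top : ∀ j → 1 ≤ j → j ≤ suc (suc r) → B j ≡ B 1
    B-top = proj₂ (proj₂ tp)

    A-plateau : ∀ j → 1 ≤ j → j ≤ suc r → A j ≡ suc (A (suc (suc r)))
    A-plateau j a b = begin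
      A j                   ≡⟨ sym (proj₁ bump j (λ e → <-irrefl e (s≤s b))) ⟩
      B j                   ≡⟨ B-top j a (≤-trans b (n≤1+n _)) ⟩
      B 1                   ≡⟨ sym (B-top (suc (suc r)) (s≤s z≤n) ≤-refl) ⟩
      B (suc (suc r))       ≡⟨ proj₂ bump ⟩
      suc (A (suc (suc r))) ∎
      where open ≡-Reasoning

    piece : Σ Piece λ pc → InPiece n pc β
    piece with BumpPlateauEnd.unbump (s≤s z≤n) A-plateau refl bump niB (suc (suc n)) (s≤s (s≤s (top-plateau-bound tp))) beyond umB
    ... | inj₁ umA = plateau-end-piece α r (top-plateau-bound tp) (uniqueMove⇒joinIrr α pα umA) A-plateau down≡β
    ... | inj₂ (v≡2 , one) = e2 , threes-then-ones⇒E₂ β pB (suc (suc r)) (s≤s z≤n) threes one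
      where
      threes : ∀ j → 1 ≤ j → j ≤ suc (suc r) → B j ≡ 3
      threes j a b = trans (B-top j a b) (trans (sym (B-top _ (s≤s z≤n) ≤-refl)) (trans (proj₂ bump) (cong suc v≡2)))

  piece : Σ Piece λ pc → InPiece n pc β
  piece with first-drop β niB (≤-trans (s≤s z≤n) (move⇒2≤top niB mvB))
  ... | suc zero , tp = TopRow.piece tp
  ... | suc (suc r) , tp = PlateauEnd.piece r tp

theorem3 : (n : ℕ) → 3 ≤ n
    → ((p q : Piece) (β : Vec ℕ (suc n)) → InPiece n p β → InPiece n q β → p ≡ q)
    × ((β : Vec ℕ (suc n)) → JoinIrr (suc n) β ⇔ (∃[ p ] InPiece n p β))
theorem3 n h = Soundness.pieces-disjoint n h , λ β → mk⇔ (λ ji → Completeness.piece n h β ji) (λ ip → Soundness.sound n h (proj₁ ip) β (proj₂ ip))
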